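{- Let $(g,n)$ be non-negative integers with $2g-2+n>0$, let $V_{g,n}\in\mathcal{G}_{g,n}^c$ be the single vertex of genus $g$ with $n$ external edges, and let $\tilde\mu$ be the generalized Möbius function on $\mathcal{G}_{g,n}^c$. Then for every $\Gamma\in\mathcal{G}_{g,n}^c$, $$\tilde\mu(\Gamma,V_{g,n})=\frac{(-1)^{|E(\Gamma)|}\,n!}{|\mathrm{Aut}(\Gamma)|},$$ where $|E(\Gamma)|$ is the number of internal edges of $\Gamma$.
   Context: A stable graph $\Gamma$ consists of a finite set of vertices $V(\Gamma)$, each $v$ carrying a genus $g_v\in\mathbb{Z}_{\ge0}$; a set of internal edges $E(\Gamma)$ joining vertices (loops allowed); and a set of external edges, each attached to one vertex. A half-edge is an external edge or an internal edge with a choice of endpoint; $\mathrm{val}_v$ is the number of half-edges at $v$; stability means $2g_v-2+\mathrm{val}_v>0$ for all $v$; the genus of a connected stable graph is $h^1(\Gamma)+\sum_vg_v$. Graphs are taken up to isomorphism; $\mathrm{Aut}(\Gamma)$ is the automorphism group (bijections of vertices and half-edges preserving genera, incidence and the pairing of half-edges into internal edges); in particular $|\mathrm{Aut}(V_{g,n})|=n!$. $\mathcal{G}_{g,n}^c$ is the set of connected stable graphs of genus $g$ with $n$ external edges. Edge contraction: (1) remove a loop at $v$ and raise $g_v$ by $1$; (2) remove a non-loop edge between $v_1\ne v_2$ and merge them into a vertex of genus $g_{v_1}+g_{v_2}$. Partial order: $\Gamma_1\ge\Gamma_2$ iff $\Gamma_1$ arises from $\Gamma_2$ by successively contracting some (possibly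 no) internal edges. For $\Gamma'\le\Gamma$ let $C(\Gamma',\Gamma)$ be the set of subsets $E\subset E(\Gamma')$ such that contracting $E$ in $\Gamma'$ yields $\Gamma$. Generalized zeta function: $\tilde\zeta(\Gamma',\Gamma)=\frac{|\mathrm{Aut}(\Gamma)|}{|\mathrm{Aut}(\Gamma')|}|C(\Gamma',\Gamma)|$ if $\Gamma'\le\Gamma$, $0$ otherwise. Generalized Möbius function $\tilde\mu$: $\tilde\mu(x,z)=0$ unless $x\le z$; $\tilde\mu(x,x)=1$; and for $x<z$, recursively, $\tilde\mu(x,z)=-\sum_{x<y\le z}\tilde\zeta(x,y)\tilde\mu(y,z)$. (Equivalently $\tilde\mu$ is the inverse of $\tilde\zeta$ under the convolution $(f*h)(x,z)=\sum_{x\le y\le z}f(x,y)h(y,z)$.) -}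

module Defs where

open import Data.Bool.Base using (Bool; true; false; _∧_; _∨_; not; if_then_else_; T)
open import Data.Nat.Base as ℕ using (ℕ; zero; suc; _≡ᵇ_; _<ᵇ_; _!)
open import Data.Fin.Base using (Fin; zero; suc; toℕ; punchOut; punchIn)
open import Data.Fin.Properties using (_≟_)
open import Data.Bool.ListAction using (all; any)
open import Data.List.Base using (List; []; _∷_; [_]; map; concatMap; allFin;
  filterᵇ; length; mapMaybe; _++_; foldr; lookup)
open import Data.List.Relation.Unary.All using (All)
open import Data.List.Relation.Unary.Any using (Any)
open import Data.Maybe.Base using (Maybe; just; nothing; fromMaybe; _>>=_)
open import Data.Product.Base using (Σ; Σ-syntax; _×_; _,_; proj₁; proj₂)
open import Data.Integer.Base as ℤ using (ℤ; -1ℤ; +_)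
open import Data.Rational.Base as ℚ using (ℚ; 0ℚ; 1ℚ)
open import Relation.Nullary.Decidable.Core using (⌊_⌋; yes; no)
open import Relation.Binary.PropositionalEquality using (_≡_; _≢_; sym)

-- The involution  pair  pairs the two
-- half-edges of an internal edge; its fixed points are the external
-- edges (legs).  External edges are unlabelled.

record Graph : Set where
  constructor mkGraph
  field
    nv    : ℕ
    nh    : ℕ
    genus : Fin nv → ℕ
    vert  : Fin nh → Fin nv
    pair  : Fin nh → Fin nh

open Graph public

_==_ : ∀ {n} → Fin n → Fin n → Bool
i == j = ⌊ i ≟ j ⌋

count : ∀ {A : Set} → (A → Bool) → List A → ℕ
count p xs = length (filterᵇ p xs)

sumℕ : List ℕ → ℕ
sumℕ = foldr ℕ._+_ 0

sumℚ : List ℚ → ℚ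
sumℚ = foldr ℚ._+_ 0ℚ

consF : ∀ {n m} → Fin m → (Fin n → Fin m) → Fin (suc n) → Fin m
consF i f zero    = i
consF i f (suc k) = f k

allFuns : (n m : ℕ) → List (Fin n → Fin m)
allFuns zero    m = [ (λ ()) ]
allFuns (suc n) m = concatMap (λ f → map (λ i → consF i f) (allFin m)) (allFuns n m)

injᵇ : ∀ {n m} → (Fin n → Fin m) → Bool
injᵇ {n} f = all (λ i → all (λ j → not (f i == f j) ∨ (i == j)) (allFin n)) (allFin n)

surjᵇ : ∀ {n m} → (Fin n → Fin m) → Bool
surjᵇ {n} {m} f = all (λ y → any (λ x → f x == y) (allFin n)) (allFin m)

bijᵇ : ∀ {n m} → (Fin n → Fin m) → Bool
bijᵇ f = injᵇ f ∧ surjᵇ f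

subsets : ∀ {A : Set} → List A → List (List A)
subsets []       = [ [] ]
subsets (x ∷ xs) = subsets xs ++ map (x ∷_) (subsets xs)

-- rational a / d  (d is always ≥ 1 where used: automorphism counts)
frac : ℤ → ℕ → ℚ
frac a zero    = 0ℚ
frac a (suc d) = a ℚ./ suc d

-- valence of a vertex: number of half-edges at v (a loop counts twice)
val : (Γ : Graph) → Fin (nv Γ) → ℕ
val Γ v = count (λ h → vert Γ h == v) (allFin (nh Γ))

legCount : Graph → ℕ
legCount Γ = count (λ h → pair Γ h == h) (allFin (nh Γ))

-- internal edges, each represented by its half-edge h with h < pair h
edgeReps : (Γ : Graph) → List (Fin (nh Γ))
edgeReps Γ = filterᵇ (λ h → toℕ h <ᵇ toℕ (pair Γ h)) (allFin (nh Γ))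

edgeCount : Graph → ℕ
edgeCount Γ = length (edgeReps Γ)

genusSum : Graph → ℕ
genusSum Γ = sumℕ (map (genus Γ) (allFin (nv Γ)))

Connected : Graph → Set
Connected Γ = (1 ℕ.≤ nv Γ) ×
  ((S : Fin (nv Γ) → Bool) → (∀ h → S (vert Γ h) ≡ S (vert Γ (pair Γ h))) →
     ∀ u w → S u ≡ S w)

record InG (g n : ℕ) (Γ : Graph) : Set where
  field
    involutive : ∀ h → pair Γ (pair Γ h) ≡ h
    stable     : ∀ v → 3 ℕ.≤ 2 ℕ.* genus Γ v ℕ.+ val Γ v
    connected  : Connected Γ
    legs       : legCount Γ ≡ n
    -- genus h¹(Γ) + Σ g_v = g, with h¹ = |E| - |V| + 1 (Γ connected)
    totalGenus : edgeCount Γ ℕ.+ 1 ℕ.+ genusSum Γ ≡ g ℕ.+ nv Γ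

Vgn : ℕ → ℕ → Graph
Vgn g n = mkGraph 1 n (λ _ → g) (λ _ → zero) (λ h → h)

isMorph : (Γ Δ : Graph) → (Fin (nv Γ) → Fin (nv Δ)) → (Fin (nh Γ) → Fin (nh Δ)) → Bool
isMorph Γ Δ α β =
  bijᵇ α ∧ bijᵇ β
  ∧ all (λ v → genus Δ (α v) ≡ᵇ genus Γ v) (allFin (nv Γ))
  ∧ all (λ h → vert Δ (β h) == α (vert Γ h)) (allFin (nh Γ))
  ∧ all (λ h → pair Δ (β h) == β (pair Γ h)) (allFin (nh Γ))

isoᵇ : Graph → Graph → Bool
isoᵇ Γ Δ = any (λ α → any (λ β → isMorph Γ Δ α β) (allFuns (nh Γ) (nh Δ)))
               (allFuns (nv Γ) (nv Δ))

autCount : Graph → ℕ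
autCount Γ = sumℕ (map (λ α → count (λ β → isMorph Γ Γ α β) (allFuns (nh Γ) (nh Γ)))
                       (allFuns (nv Γ) (nv Γ)))

removeFin : ∀ {n} → Fin (suc n) → Fin (suc n) → Maybe (Fin n)
removeFin i j with i ≟ j
... | yes _ = nothing
... | no p  = just (punchOut p)

mergeV : (nv : ℕ) → (Fin nv → ℕ) → (va vb : Fin nv) →
         Σ[ nv' ∈ ℕ ] ((Fin nv' → ℕ) × (Fin nv → Fin nv'))
mergeV nv gen va vb with va ≟ vb
-- (1) loop: raise the genus of the vertex by one
... | yes _ = nv , (λ v → gen v ℕ.+ (if v == va then 1 else 0)) , (λ v → v)
-- (2) non-loop: merge vb into va, genus g_va + g_vb
mergeV (suc m) gen va vb | no p =
  let vaNew = punchOut {i = vb} {j = va} (λ e → p (sym e)) in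
  m , (λ w → gen (punchIn vb w) ℕ.+ (if w == vaNew then gen vb else 0))
    , (λ u → fromMaybe vaNew (removeFin vb u))

-- remove the two half-edges a and b (b ≠ a) of an edge
contractAux : (nv k : ℕ) → (Fin nv → ℕ) → (Fin (suc (suc k)) → Fin nv) →
              (Fin (suc (suc k)) → Fin (suc (suc k))) →
              (a : Fin (suc (suc k))) → Fin (suc k) →
              Σ[ Γ' ∈ Graph ] (Fin (suc (suc k)) → Maybe (Fin (nh Γ')))
contractAux nv k gen vert pair a b' =
  let rem2 : Fin (suc (suc k)) → Maybe (Fin k)
      rem2 h = removeFin a h >>= removeFin b'
      old : Fin k → Fin (suc (suc k))
      old h' = punchIn a (punchIn b' h')
      M = mergeV nv gen (vert a) (vert (pair a))
  in mkGraph (proj₁ M) k (proj₁ (proj₂ M))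
             (λ h' → proj₂ (proj₂ M) (vert (old h')))
             (λ h' → fromMaybe h' (rem2 (pair (old h'))))
     , rem2

-- contract the internal edge containing half-edge a; also returns the
-- map from old half-edges to surviving new half-edges.
-- (If a is a leg, nothing happens.)
contract1 : (Γ : Graph) → Fin (nh Γ) →
            Σ[ Γ' ∈ Graph ] (Fin (nh Γ) → Maybe (Fin (nh Γ')))
contract1 (mkGraph nv (suc k) gen vert pair) a with removeFin a (pair a)
... | nothing = mkGraph nv (suc k) gen vert pair , just
contract1 (mkGraph nv (suc (suc k)) gen vert pair) a | just b' =
  contractAux nv k gen vert pair a b'

contractL : ℕ → (Γ : Graph) → List (Fin (nh Γ)) → Graph
contractL _       Γ []       = Γ
contractL zero    Γ (_ ∷ _)  = Γ
contractL (suc f) Γ (a ∷ as) =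
  contractL f (proj₁ (contract1 Γ a)) (mapMaybe (proj₂ (contract1 Γ a)) as)

contractSet : (Γ : Graph) → List (Fin (nh Γ)) → Graph
contractSet Γ E = contractL (length E) Γ E

cCount : Graph → Graph → ℕ
cCount Γ' Γ = count (λ E → isoᵇ (contractSet Γ' E) Γ) (subsets (edgeReps Γ'))

leqᵇ : Graph → Graph → Bool
leqᵇ Γ' Γ = not (cCount Γ' Γ ≡ᵇ 0)

ltᵇ : Graph → Graph → Bool
ltᵇ Γ' Γ = leqᵇ Γ' Γ ∧ not (isoᵇ Γ' Γ)

zeta : Graph → Graph → ℚ
zeta Γ' Γ = frac (+ (autCount Γ ℕ.* cCount Γ' Γ)) (autCount Γ')

-- L : a list of representatives of the isomorphism classes of 𝒢ᶜ_{g,n}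
-- (one per class), so sums over 𝒢ᶜ_{g,n} are sums over L.
IsRepList : ℕ → ℕ → List Graph → Set
IsRepList g n L =
  All (InG g n) L ×
  ((Γ : Graph) → InG g n Γ → Any (λ Δ → T (isoᵇ Γ Δ)) L) ×
  ((i j : Fin (length L)) → T (isoᵇ (lookup L i) (lookup L j)) → i ≡ j)

-- recursion for μ̃ with fuel (fuel decreases along x < y since
-- contraction strictly decreases the number of half-edges)
muF : List Graph → ℕ → Graph → Graph → ℚ
muF L zero    x z = 0ℚ
muF L (suc f) x z =
  if isoᵇ x z then 1ℚ
  else if leqᵇ x z
    then ℚ.- sumℚ (map (λ y → if ltᵇ x y ∧ leqᵇ y z
                                 then zeta x y ℚ.* muF L f y z else 0ℚ) L)
    else 0ℚ

mu : List Graph → Graph → Graph → ℚ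
mu L x z = muF L (suc (nh x)) x z

-- Induction on the number of half-edges, along the defining recursion of μ̃.  For Γ ≇ V_{g,n},
-- μ̃(Γ,V) = −Σ_{Γ<y} ζ̃(Γ,y) μ̃(y,V), and inserting the inductive value (−1)^{|E(y)|} n!/|Aut y|
-- for μ̃(y,V) cancels |Aut y|: μ̃(Γ,V) = −(n!/|Aut Γ|) Σ_{y ≇ Γ} |C(Γ,y)| (−1)^{|E(y)|}.
-- Summed over all y, Σ_y |C(Γ,y)| (−1)^{|E(y)|} visits every subset E ⊆ E(Γ) exactly once,
-- through the representative of Γ/E, with sign (−1)^{|E(Γ)|−|E|}; since E(Γ) ≠ ∅ it vanishes.
-- The excluded term y ≅ Γ comes from E = ∅ alone and equals (−1)^{|E(Γ)|}, whence the formula.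

{-# OPTIONS --safe #-}
module Submission where

open import Defs
open import Data.Bool.Base using (Bool; true; false; _∧_; _∨_; not; if_then_else_; T)
open import Data.Bool.Properties using (T-∧; T-∨; T-≡; if-cong)
open import Data.Bool.ListAction using (all; any)
open import Data.Nat.Base as ℕ using (ℕ; zero; suc; _+_; _*_; _∸_; _≤_; _<_; _!; z≤n; s≤s; _≡ᵇ_; _<ᵇ_)
open import Data.Nat.Properties hiding (_≟_; suc-injective)
import Data.Nat.Properties as ℕ
open import Data.Nat.Combinatorics using (nPn≡n!)
open import Data.Nat.Combinatorics.Base using (_P′_)
open import Data.Fin.Base using (Fin; zero; suc; punchIn; punchOut; toℕ)
open import Data.Fin.Properties using (_≟_; nonZeroIndex; suc-injective; any?; injective⇒≤; toℕ-injective;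
  punchIn-injective; punchInᵢ≢i; punchIn-punchOut; punchOut-punchIn; punchOut-cong; punchOut-injective)
open import Data.List.Properties using (length-map; map-cong; map-cong-local; map-∘)
open import Data.List.Base
  using (List; []; _∷_; map; concatMap; allFin; filterᵇ; length; _++_; foldr; tabulate; mapMaybe; lookup; null)
open import Data.List.Relation.Unary.All as All using (All; []; _∷_)
import Data.List.Relation.Unary.All.Properties as All
open import Data.List.Relation.Unary.Any as Any using (Any; here; there)
import Data.List.Relation.Unary.Any.Properties as Any
open import Data.Maybe.Base using (Maybe; just; nothing; fromMaybe; _>>=_)
open import Data.Maybe.Properties using (just-injective)
open import Data.Product.Base using (Σ-syntax; ∃; _×_; _,_; proj₁; proj₂)
open import Data.Sum.Base using (inj₁; inj₂)
open import Data.Empty using (⊥-elim)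
open import Data.Unit.Base using (tt)
open import Function.Base using (_∘_; id; _⟨_⟩_)
open import Function.Bundles using (Equivalence)
open import Function.Definitions using (Injective)
open import Relation.Nullary using (¬_; yes; no; Dec; contradiction)
open import Relation.Nullary.Decidable.Core using (T?; toWitness; fromWitness)
open import Relation.Binary.PropositionalEquality
open import Relation.Binary.Definitions using (tri<; tri≈; tri>)
open import Data.Fin.Permutation using (Permutation; permutation)
open import Algebra.Properties.CommutativeMonoid.Sum +-0-commutativeMonoid
  using (sum; sum-cong-≗; ∑-distrib-+; sum-remove; sum-permute; sum-replicate-zero)
open import Data.Integer.Base as ℤ using (ℤ; 0ℤ; 1ℤ; -1ℤ)
import Data.Integer.Properties as ℤ
import Algebra.Properties.CommutativeSemigroup ℤ.+-commutativeSemigroup as ℤ+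
import Algebra.Properties.AbelianGroup ℤ.+-0-abelianGroup as ℤ+-group
import Algebra.Solver.CommutativeMonoid ℤ.*-1-commutativeMonoid as ℤ*
open ℤ* using (_⊕_; _⊜_)
open import Data.Rational.Base as ℚ using (ℚ; 0ℚ; 1ℚ; fromℚᵘ; toℚᵘ)
import Data.Rational.Properties as ℚ
import Algebra.Properties.Group ℚ.+-0-group as ℚ+-group
open import Data.Rational.Unnormalised.Base as ℚᵘ using (mkℚᵘ; *≡*)
import Data.Rational.Unnormalised.Properties as ℚᵘ
open import Data.Nat.Solver using (module +-*-Solver)
open +-*-Solver

open Equivalence using (to; from)

private
  variable
    n m k : ℕ
    A B : Set

χ : Bool → ℕ
χ true  = 1
χ false = 0

χ-true : ∀ {b} → T b → χ b ≡ 1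
χ-true {true} _ = refl

χ-false : ∀ {b} → ¬ T b → χ b ≡ 0
χ-false {false} _ = refl
χ-false {true}  ¬t = contradiction tt ¬t

T-ext : ∀ {a b} → (T a → T b) → (T b → T a) → a ≡ b
T-ext {false} {false} _ _ = refl
T-ext {false} {true}  _ g = ⊥-elim (g tt)
T-ext {true}  {false} f _ = ⊥-elim (f tt)
T-ext {true}  {true}  _ _ = refl

T⇒≡true : ∀ {b} → T b → b ≡ true
T⇒≡true = to T-≡

¬T⇒≡false : ∀ {b} → ¬ T b → b ≡ false
¬T⇒≡false {false} _  = refl
¬T⇒≡false {true}  ¬t = contradiction tt ¬t

T-not⁺ : ∀ {b} → ¬ T b → T (not b)
T-not⁺ {false} _  = tt
T-not⁺ {true}  ¬t = ¬t tt

T-not⁻ : ∀ {b} → T (not b) → ¬ T b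
T-not⁻ {false} _ ()

==⇒≡ : {i j : Fin n} → T (i == j) → i ≡ j
==⇒≡ = toWitness

≡⇒== : {i j : Fin n} → i ≡ j → T (i == j)
≡⇒== = fromWitness

==-refl : (i : Fin n) → (i == i) ≡ true
==-refl i = T⇒≡true (≡⇒== refl)

==-sym : (i j : Fin n) → (i == j) ≡ (j == i)
==-sym i j = T-ext (≡⇒== ∘ sym ∘ ==⇒≡) (≡⇒== ∘ sym ∘ ==⇒≡)

≢⇒==-false : {i j : Fin n} → i ≢ j → (i == j) ≡ false
≢⇒==-false i≢j = ¬T⇒≡false (i≢j ∘ ==⇒≡)

all-allFin⁻ : (p : Fin n → Bool) → T (all p (allFin n)) → ∀ i → T (p i)
all-allFin⁻ p t = All.tabulate⁻ (All.all⁺ p _ t)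

all-allFin⁺ : (p : Fin n → Bool) → (∀ i → T (p i)) → T (all p (allFin n))
all-allFin⁺ p h = All.all⁻ p (All.tabulate⁺ h)

any-allFin⁻ : (p : Fin n → Bool) → T (any p (allFin n)) → ∃ λ i → T (p i)
any-allFin⁻ p t = Any.tabulate⁻ (Any.any⁻ p _ t)

any-allFin⁺ : (p : Fin n → Bool) → ∀ i → T (p i) → T (any p (allFin n))
any-allFin⁺ p i t = Any.any⁺ p (Any.tabulate⁺ i t)

count-tabulate : (p : A → Bool) (f : Fin n → A) → count p (tabulate f) ≡ sum (χ ∘ p ∘ f)
count-tabulate {n = zero}  p f = refl
count-tabulate {n = suc n} p f with p (f zero)
... | true  = cong suc (count-tabulate p (f ∘ suc))
... | false = count-tabulate p (f ∘ suc)

count-allFin : (p : Fin n → Bool) → count p (allFin n) ≡ sum (χ ∘ p)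
count-allFin p = count-tabulate p id

sumℕ-tabulate : (f : A → ℕ) (g : Fin n → A) → sumℕ (map f (tabulate g)) ≡ sum (f ∘ g)
sumℕ-tabulate {n = zero}  f g = refl
sumℕ-tabulate {n = suc n} f g = cong (f (g zero) +_) (sumℕ-tabulate f (g ∘ suc))

sum-one : sum {n} (λ _ → 1) ≡ n
sum-one {zero}  = refl
sum-one {suc n} = cong suc (sum-one {n})

sum-single : (j : Fin n) (c : ℕ) → sum (λ i → if i == j then c else 0) ≡ c
sum-single {suc n} j c = begin
  sum (λ i → if i == j then c else 0)                  ≡⟨ sum-remove {i = j} (λ i → if i == j then c else 0) ⟩
  (if j == j then c else 0) + sum (λ i → if punchIn j i == j then c else 0)
    ≡⟨ cong₂ _+_ (cong (if_then c else 0) (==-refl j)) (sum-cong-≗ off-j) ⟩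
  c + sum {n} (λ _ → 0)                                ≡⟨ cong (c +_) (sum-replicate-zero n) ⟩
  c + 0                                                ≡⟨ +-identityʳ c ⟩
  c                                                    ∎
  where
  open ≡-Reasoning
  off-j : ∀ i → (if punchIn j i == j then c else 0) ≡ 0
  off-j i = cong (if_then c else 0) (≢⇒==-false (punchInᵢ≢i j i))

count+count-not : (p : Fin n → Bool) → sum (χ ∘ p) + sum (χ ∘ not ∘ p) ≡ n
count+count-not {zero}  p = refl
count+count-not {suc n} p with p zero
... | true  = cong suc (count+count-not (p ∘ suc))
... | false = +-suc _ _ ⟨ trans ⟩ cong suc (count+count-not (p ∘ suc))

count-false : (xs : List A) → count (λ _ → false) xs ≡ 0
count-false []       = refl
count-false (x ∷ xs) = count-false xs

count-++ : (p : A → Bool) (xs ys : List A) → count p (xs ++ ys) ≡ count p xs + count p ys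
count-++ p []       ys = refl
count-++ p (x ∷ xs) ys with p x
... | true  = cong suc (count-++ p xs ys)
... | false = count-++ p xs ys

count-map : (p : B → Bool) (f : A → B) (xs : List A) → count p (map f xs) ≡ count (p ∘ f) xs
count-map p f []       = refl
count-map p f (x ∷ xs) with p (f x)
... | true  = cong suc (count-map p f xs)
... | false = count-map p f xs

count-cong : (p q : A → Bool) (xs : List A) → (∀ x → p x ≡ q x) → count p xs ≡ count q xs
count-cong p q []       e = refl
count-cong p q (x ∷ xs) e rewrite e x with q x
... | true  = cong suc (count-cong p q xs e)
... | false = count-cong p q xs e

count-concatMap : (p : B → Bool) (f : A → List B) (xs : List A) →
                  count p (concatMap f xs) ≡ sumℕ (map (count p ∘ f) xs)
count-concatMap p f []       = refl
count-concatMap p f (x ∷ xs) =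
  count-++ p (f x) _ ⟨ trans ⟩ cong (count p (f x) +_) (count-concatMap p f xs)

count-pos : (p : A → Bool) (xs : List A) → Any (T ∘ p) xs → 1 ≤ count p xs
count-pos p (x ∷ xs) (here t) rewrite T⇒≡true t = s≤s z≤n
count-pos p (x ∷ xs) (there a) with p x
... | true  = s≤s z≤n
... | false = count-pos p xs a

count-pos⁻ : (p : A → Bool) (xs : List A) → 1 ≤ count p xs → Any (T ∘ p) xs
count-pos⁻ p (x ∷ xs) le with p x in eq
... | true  = here (from T-≡ eq)
... | false = there (count-pos⁻ p xs le)

sumℕ-cong : (f g : A → ℕ) (xs : List A) → (∀ x → f x ≡ g x) → sumℕ (map f xs) ≡ sumℕ (map g xs)
sumℕ-cong f g []       e = refl
sumℕ-cong f g (x ∷ xs) e = cong₂ _+_ (e x) (sumℕ-cong f g xs e)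

sumℕ-if : (p : A → Bool) (c : ℕ) (xs : List A) →
          sumℕ (map (λ x → if p x then c else 0) xs) ≡ count p xs * c
sumℕ-if p c []       = refl
sumℕ-if p c (x ∷ xs) with p x
... | true  = cong (c +_) (sumℕ-if p c xs)
... | false = sumℕ-if p c xs

sumℕ-pos : (f : A → ℕ) (xs : List A) → Any (λ x → 1 ≤ f x) xs → 1 ≤ sumℕ (map f xs)
sumℕ-pos f (x ∷ xs) (here t)  = ≤-trans t (m≤m+n _ _)
sumℕ-pos f (x ∷ xs) (there a) = ≤-trans (sumℕ-pos f xs a) (m≤n+m _ _)

-- Injections and bijections between finite sets

Onto : (Fin n → Fin m) → Set
Onto {n} f = ∀ y → ∃ λ (x : Fin n) → f x ≡ y

allFuns-complete : (f : Fin n → Fin m) → Any (_≗ f) (allFuns n m)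
allFuns-complete {zero}      f = here (λ ())
allFuns-complete {suc n} {m} f = Any.concat⁺ (Any.map⁺ (Any.map extend (allFuns-complete (f ∘ suc))))
  where
  extend : ∀ {f₀} → f₀ ≗ f ∘ suc → Any (_≗ f) (map (λ i → consF i f₀) (allFin m))
  extend f₀≗ = Any.map⁺ (Any.tabulate⁺ (f zero) λ { zero → refl ; (suc x) → f₀≗ x })

injᵇ⁻ : (f : Fin n → Fin m) → T (injᵇ f) → Injective _≡_ _≡_ f
injᵇ⁻ f t {i} {j} fi≡fj with to T-∨ (all-allFin⁻ _ (all-allFin⁻ _ t i) j)
... | inj₁ fi≢fj = contradiction (≡⇒== fi≡fj) (T-not⁻ fi≢fj)
... | inj₂ i==j  = ==⇒≡ i==j

injᵇ⁺ : (f : Fin n → Fin m) → Injective _≡_ _≡_ f → T (injᵇ f)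
injᵇ⁺ f inj = all-allFin⁺ _ λ i → all-allFin⁺ _ λ j → distinct-or-equal i j
  where
  distinct-or-equal : ∀ i j → T (not (f i == f j) ∨ (i == j))
  distinct-or-equal i j with f i ≟ f j
  ... | yes fi≡fj = ≡⇒== (inj fi≡fj)
  ... | no  _     = tt

surjᵇ⁻ : (f : Fin n → Fin m) → T (surjᵇ f) → Onto f
surjᵇ⁻ f t y = let (x , fx==y) = any-allFin⁻ _ (all-allFin⁻ _ t y) in x , ==⇒≡ fx==y

surjᵇ⁺ : (f : Fin n → Fin m) → Onto f → T (surjᵇ f)
surjᵇ⁺ f onto = all-allFin⁺ _ λ y → let (x , fx≡y) = onto y in any-allFin⁺ _ x (≡⇒== fx≡y)

inImage : (Fin n → Fin m) → Fin m → Bool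
inImage {zero}  f y = false
inImage {suc n} f y = f zero == y ∨ inImage (f ∘ suc) y

inImage⁺ : (f : Fin n → Fin m) (x : Fin n) → T (inImage f (f x))
inImage⁺ f zero    = from (T-∨ {f zero == f zero}) (inj₁ (≡⇒== refl))
inImage⁺ f (suc x) = from (T-∨ {f zero == f (suc x)}) (inj₂ (inImage⁺ (f ∘ suc) x))

inImage⁻ : (f : Fin n → Fin m) {y : Fin m} → T (inImage f y) → ∃ λ x → f x ≡ y
inImage⁻ {suc n} f t with to T-∨ t
... | inj₁ hit  = zero , ==⇒≡ hit
... | inj₂ hits = let (x , e) = inImage⁻ (f ∘ suc) hits in suc x , e

χ-∨-disjoint : ∀ a b → ¬ (T a × T b) → χ (a ∨ b) ≡ χ a + χ b
χ-∨-disjoint true  true  disj = contradiction (tt , tt) disj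
χ-∨-disjoint true  false _    = refl
χ-∨-disjoint false b     _    = refl

image-size : (f : Fin n → Fin m) → Injective _≡_ _≡_ f → sum (χ ∘ inImage f) ≡ n
image-size {zero}  {m} f _   = sum-replicate-zero m
image-size {suc n} {m} f inj = begin
  sum (χ ∘ inImage f)
    ≡⟨ sum-cong-≗ (λ y → χ-∨-disjoint (f zero == y) _ (not-hit-twice y)) ⟩
  sum (λ y → χ (f zero == y) + χ (inImage (f ∘ suc) y))
    ≡⟨ ∑-distrib-+ (χ ∘ (f zero ==_)) (χ ∘ inImage (f ∘ suc)) ⟩
  sum (χ ∘ (f zero ==_)) + sum (χ ∘ inImage (f ∘ suc))
    ≡⟨ cong₂ _+_ hit-once (image-size (f ∘ suc) (suc-injective ∘ inj)) ⟩
  1 + n ∎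
  where
  open ≡-Reasoning
  not-hit-twice : ∀ y → ¬ (T (f zero == y) × T (inImage (f ∘ suc) y))
  not-hit-twice y (hit , hits) with inImage⁻ (f ∘ suc) hits
  ... | x , fx≡y with () ← inj (==⇒≡ hit ⟨ trans ⟩ sym fx≡y)
  hit-once : sum (χ ∘ (f zero ==_)) ≡ 1
  hit-once = sum-cong-≗ (λ y → cong χ (==-sym (f zero) y) ⟨ trans ⟩ χ-if (y == f zero))
             ⟨ trans ⟩ sum-single (f zero) 1
    where
    χ-if : ∀ b → χ b ≡ (if b then 1 else 0)
    χ-if true  = refl
    χ-if false = refl

injective⇒onto : (f : Fin n → Fin n) → Injective _≡_ _≡_ f → Onto f
injective⇒onto {suc n} f inj y with any? (λ x → f x ≟ y)
... | yes hit  = hit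
... | no  miss = contradiction (injective⇒≤ squeezed-injective) 1+n≰n
  where
  missed : ∀ x → y ≢ f x
  missed x y≡fx = miss (x , sym y≡fx)
  squeezed : Fin (suc n) → Fin n
  squeezed x = punchOut (missed x)
  squeezed-injective : Injective _≡_ _≡_ squeezed
  squeezed-injective {x} {x′} e = inj (punchOut-injective (missed x) (missed x′) e)

injᵇ-consF : (i : Fin m) (f : Fin n → Fin m) → injᵇ (consF i f) ≡ injᵇ f ∧ not (inImage f i)
injᵇ-consF {m} {n} i f = T-ext forward backward
  where
  forward : T (injᵇ (consF i f)) → T (injᵇ f ∧ not (inImage f i))
  forward t = from T-∧ (injᵇ⁺ f (suc-injective ∘ inj) , T-not⁺ (λ hit → fresh (inImage⁻ f hit)))
    where
    inj = injᵇ⁻ (consF i f) t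
    fresh : ¬ ∃ λ x → f x ≡ i
    fresh (x , fx≡i) with () ← inj {suc x} {zero} fx≡i
  backward : T (injᵇ f ∧ not (inImage f i)) → T (injᵇ (consF i f))
  backward t = injᵇ⁺ (consF i f) inj
    where
    fresh = T-not⁻ (proj₂ (to T-∧ t))
    inj : Injective _≡_ _≡_ (consF i f)
    inj {zero}  {zero}  _ = refl
    inj {zero}  {suc y} e = contradiction (subst (T ∘ inImage f) (sym e) (inImage⁺ f y)) fresh
    inj {suc x} {zero}  e = contradiction (subst (T ∘ inImage f) e (inImage⁺ f x)) fresh
    inj {suc x} {suc y} e = cong suc (injᵇ⁻ f (proj₁ (to T-∧ t)) e)

injective-extensions : (f : Fin n → Fin m) →
  count (λ i → injᵇ (consF i f)) (allFin m) ≡ (if injᵇ f then m ∸ n else 0)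
injective-extensions {n} {m} f =
  count-cong _ _ (allFin m) (λ i → injᵇ-consF i f) ⟨ trans ⟩ by-cases (injᵇ f) refl
  where
  by-cases : ∀ b → injᵇ f ≡ b →
    count (λ i → b ∧ not (inImage f i)) (allFin m) ≡ (if b then m ∸ n else 0)
  by-cases false _ = count-false (allFin m)
  by-cases true  e = begin
    count (not ∘ inImage f) (allFin m)   ≡⟨ count-allFin (not ∘ inImage f) ⟩
    free                                 ≡⟨ m+n∸m≡n n free ⟨
    n + free ∸ n                         ≡⟨ cong (λ k → k + free ∸ n) (image-size f (injᵇ⁻ f (from T-≡ e))) ⟨
    sum (χ ∘ inImage f) + free ∸ n       ≡⟨ cong (_∸ n) (count+count-not (inImage f)) ⟩
    m ∸ n                                ∎
    where
    open ≡-Reasoning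
    free = sum (χ ∘ not ∘ inImage f)

count-injections : ∀ n m → count injᵇ (allFuns n m) ≡ m P′ n
count-injections zero    m = refl
count-injections (suc n) m = begin
  count injᵇ (allFuns (suc n) m)
    ≡⟨ count-concatMap injᵇ _ (allFuns n m) ⟩
  sumℕ (map (λ f → count injᵇ (map (λ i → consF i f) (allFin m))) (allFuns n m))
    ≡⟨ sumℕ-cong _ _ (allFuns n m) (λ f → count-map injᵇ _ (allFin m) ⟨ trans ⟩ injective-extensions f) ⟩
  sumℕ (map (λ f → if injᵇ f then m ∸ n else 0) (allFuns n m))
    ≡⟨ sumℕ-if injᵇ (m ∸ n) (allFuns n m) ⟩
  count injᵇ (allFuns n m) * (m ∸ n)
    ≡⟨ cong (_* (m ∸ n)) (count-injections n m) ⟩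
  (m P′ n) * (m ∸ n)
    ≡⟨ *-comm (m P′ n) (m ∸ n) ⟩
  m P′ suc n ∎
  where open ≡-Reasoning

bijᵇ≡injᵇ : (f : Fin n → Fin n) → bijᵇ f ≡ injᵇ f
bijᵇ≡injᵇ f with injᵇ f in eq
... | false = refl
... | true  = T⇒≡true (surjᵇ⁺ f (injective⇒onto f (injᵇ⁻ f (from T-≡ eq))))

count-bijections : ∀ n → count bijᵇ (allFuns n n) ≡ n !
count-bijections n =
  count-cong bijᵇ injᵇ (allFuns n n) bijᵇ≡injᵇ ⟨ trans ⟩ count-injections n n ⟨ trans ⟩
  cong (if_then n P′ n else 0) (sym (T⇒≡true (≤⇒≤ᵇ (≤-refl {n})))) ⟨ trans ⟩ nPn≡n! n

-- Graph isomorphisms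

record IsIsomorphism (Γ Δ : Graph) (α : Fin (nv Γ) → Fin (nv Δ)) (β : Fin (nh Γ) → Fin (nh Δ)) : Set where
  field
    α-injective : Injective _≡_ _≡_ α
    α-onto      : Onto α
    β-injective : Injective _≡_ _≡_ β
    β-onto      : Onto β
    genus-pres  : ∀ v → genus Δ (α v) ≡ genus Γ v
    vert-pres   : ∀ h → vert Δ (β h) ≡ α (vert Γ h)
    pair-pres   : ∀ h → pair Δ (β h) ≡ β (pair Γ h)

open IsIsomorphism

isMorph⁻ : ∀ Γ Δ α β → T (isMorph Γ Δ α β) → IsIsomorphism Γ Δ α β
isMorph⁻ Γ Δ α β t =
  let (bij-α , t₁)  = to T-∧ t
      (bij-β , t₂)  = to T-∧ t₁
      (genus , t₃)  = to T-∧ t₂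
      (vert , pair) = to T-∧ t₃
      (inj-α , surj-α) = to T-∧ bij-α
      (inj-β , surj-β) = to T-∧ bij-β
  in record
    { α-injective = injᵇ⁻ α inj-α
    ; α-onto      = surjᵇ⁻ α surj-α
    ; β-injective = injᵇ⁻ β inj-β
    ; β-onto      = surjᵇ⁻ β surj-β
    ; genus-pres  = λ v → ≡ᵇ⇒≡ _ _ (all-allFin⁻ _ genus v)
    ; vert-pres   = λ h → ==⇒≡ (all-allFin⁻ _ vert h)
    ; pair-pres   = λ h → ==⇒≡ (all-allFin⁻ _ pair h)
    }

isMorph⁺ : ∀ Γ Δ α β → IsIsomorphism Γ Δ α β → T (isMorph Γ Δ α β)
isMorph⁺ Γ Δ α β i =
  from T-∧ (from T-∧ (injᵇ⁺ α (α-injective i) , surjᵇ⁺ α (α-onto i)) ,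
  from T-∧ (from T-∧ (injᵇ⁺ β (β-injective i) , surjᵇ⁺ β (β-onto i)) ,
  from T-∧ (all-allFin⁺ _ (λ v → ≡⇒≡ᵇ _ _ (genus-pres i v)) ,
  from T-∧ (all-allFin⁺ _ (≡⇒== ∘ vert-pres i) ,
            all-allFin⁺ _ (≡⇒== ∘ pair-pres i)))))

IsIsomorphism-resp-≗ : ∀ {Γ Δ α β α′ β′} → α′ ≗ α → β′ ≗ β →
                       IsIsomorphism Γ Δ α β → IsIsomorphism Γ Δ α′ β′
IsIsomorphism-resp-≗ {Δ = Δ} α′≗α β′≗β i = record
  { α-injective = λ {x} {y} e → α-injective i (sym (α′≗α x) ⟨ trans ⟩ e ⟨ trans ⟩ α′≗α y)
  ; α-onto      = λ y → let (x , e) = α-onto i y in x , (α′≗α x ⟨ trans ⟩ e)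
  ; β-injective = λ {x} {y} e → β-injective i (sym (β′≗β x) ⟨ trans ⟩ e ⟨ trans ⟩ β′≗β y)
  ; β-onto      = λ y → let (x , e) = β-onto i y in x , (β′≗β x ⟨ trans ⟩ e)
  ; genus-pres  = λ v → cong (genus Δ) (α′≗α v) ⟨ trans ⟩ genus-pres i v
  ; vert-pres   = λ h → cong (vert Δ) (β′≗β h) ⟨ trans ⟩ vert-pres i h ⟨ trans ⟩ sym (α′≗α _)
  ; pair-pres   = λ h → cong (pair Δ) (β′≗β h) ⟨ trans ⟩ pair-pres i h ⟨ trans ⟩ sym (β′≗β _)
  }

isomorphism-listed : ∀ Γ Δ α β → IsIsomorphism Γ Δ α β →
  Any (λ α′ → Any (T ∘ isMorph Γ Δ α′) (allFuns (nh Γ) (nh Δ))) (allFuns (nv Γ) (nv Δ))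
isomorphism-listed Γ Δ α β i = Any.map (λ α′≗α → Any.map (λ β′≗β →
  isMorph⁺ Γ Δ _ _ (IsIsomorphism-resp-≗ α′≗α β′≗β i)) (allFuns-complete β)) (allFuns-complete α)

_≅_ : Graph → Graph → Set
Γ ≅ Δ = Σ[ α ∈ (Fin (nv Γ) → Fin (nv Δ)) ] Σ[ β ∈ (Fin (nh Γ) → Fin (nh Δ)) ] IsIsomorphism Γ Δ α β

isoᵇ⁻ : ∀ Γ Δ → T (isoᵇ Γ Δ) → Γ ≅ Δ
isoᵇ⁻ Γ Δ t =
  let (α , some-β) = Any.satisfied
        (Any.any⁻ (λ α → any (isMorph Γ Δ α) (allFuns (nh Γ) (nh Δ))) (allFuns (nv Γ) (nv Δ)) t)
      (β , i)      = Any.satisfied (Any.any⁻ (isMorph Γ Δ α) (allFuns (nh Γ) (nh Δ)) some-β)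
  in α , β , isMorph⁻ Γ Δ α β i

isoᵇ⁺ : ∀ Γ Δ → Γ ≅ Δ → T (isoᵇ Γ Δ)
isoᵇ⁺ Γ Δ (α , β , i) =
  Any.any⁺ (λ α → any (isMorph Γ Δ α) (allFuns (nh Γ) (nh Δ)))
    (Any.map (Any.any⁺ (isMorph Γ Δ _)) (isomorphism-listed Γ Δ α β i))

≅-refl : ∀ Γ → Γ ≅ Γ
≅-refl Γ = id , id , record
  { α-injective = id ; α-onto = λ y → y , refl ; β-injective = id ; β-onto = λ y → y , refl
  ; genus-pres = λ _ → refl ; vert-pres = λ _ → refl ; pair-pres = λ _ → refl }

≅-sym : ∀ {Γ Δ} → Γ ≅ Δ → Δ ≅ Γ
≅-sym {Δ = Δ} (α , β , i) = α⁻¹ , β⁻¹ , record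
  { α-injective = λ {x} {y} e → sym (α∘α⁻¹ x) ⟨ trans ⟩ cong α e ⟨ trans ⟩ α∘α⁻¹ y
  ; α-onto      = λ x → α x , α-injective i (α∘α⁻¹ (α x))
  ; β-injective = λ {x} {y} e → sym (β∘β⁻¹ x) ⟨ trans ⟩ cong β e ⟨ trans ⟩ β∘β⁻¹ y
  ; β-onto      = λ x → β x , β-injective i (β∘β⁻¹ (β x))
  ; genus-pres  = λ w → sym (genus-pres i (α⁻¹ w)) ⟨ trans ⟩ cong (genus Δ) (α∘α⁻¹ w)
  ; vert-pres   = λ h → α-injective i
      (sym (vert-pres i (β⁻¹ h)) ⟨ trans ⟩ cong (vert Δ) (β∘β⁻¹ h) ⟨ trans ⟩ sym (α∘α⁻¹ _))
  ; pair-pres   = λ h → β-injective i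
      (sym (pair-pres i (β⁻¹ h)) ⟨ trans ⟩ cong (pair Δ) (β∘β⁻¹ h) ⟨ trans ⟩ sym (β∘β⁻¹ _))
  }
  where
  α⁻¹ = proj₁ ∘ α-onto i
  α∘α⁻¹ = proj₂ ∘ α-onto i
  β⁻¹ = proj₁ ∘ β-onto i
  β∘β⁻¹ = proj₂ ∘ β-onto i

≅-trans : ∀ {Γ Δ Θ} → Γ ≅ Δ → Δ ≅ Θ → Γ ≅ Θ
≅-trans (α , β , i) (α′ , β′ , i′) = α′ ∘ α , β′ ∘ β , record
  { α-injective = α-injective i ∘ α-injective i′
  ; α-onto      = λ z → let (y , e′) = α-onto i′ z ; (x , e) = α-onto i y in x , (cong α′ e ⟨ trans ⟩ e′)
  ; β-injective = β-injective i ∘ β-injective i′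
  ; β-onto      = λ z → let (y , e′) = β-onto i′ z ; (x , e) = β-onto i y in x , (cong β′ e ⟨ trans ⟩ e′)
  ; genus-pres  = λ v → genus-pres i′ (α v) ⟨ trans ⟩ genus-pres i v
  ; vert-pres   = λ h → vert-pres i′ (β h) ⟨ trans ⟩ cong α′ (vert-pres i h)
  ; pair-pres   = λ h → pair-pres i′ (β h) ⟨ trans ⟩ cong β′ (pair-pres i h)
  }

isoᵇ-sym : ∀ Γ Δ → T (isoᵇ Γ Δ) → T (isoᵇ Δ Γ)
isoᵇ-sym Γ Δ t = isoᵇ⁺ Δ Γ (≅-sym (isoᵇ⁻ Γ Δ t))

isoᵇ-trans : ∀ Γ Δ Θ → T (isoᵇ Γ Δ) → T (isoᵇ Δ Θ) → T (isoᵇ Γ Θ)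
isoᵇ-trans Γ Δ Θ t u = isoᵇ⁺ Γ Θ (≅-trans (isoᵇ⁻ Γ Δ t) (isoᵇ⁻ Δ Θ u))

≅⇒nh≡ : ∀ {Γ Δ} → Γ ≅ Δ → nh Γ ≡ nh Δ
≅⇒nh≡ iso@(_ , _ , i) = ≤-antisym (injective⇒≤ (β-injective i)) (injective⇒≤ (β-injective i⁻¹))
  where i⁻¹ = proj₂ (proj₂ (≅-sym iso))

≅⇒nv≡ : ∀ {Γ Δ} → Γ ≅ Δ → nv Γ ≡ nv Δ
≅⇒nv≡ iso@(_ , _ , i) = ≤-antisym (injective⇒≤ (α-injective i)) (injective⇒≤ (α-injective i⁻¹))
  where i⁻¹ = proj₂ (proj₂ (≅-sym iso))

autCount-pos : ∀ Γ → 1 ≤ autCount Γ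
autCount-pos Γ = sumℕ-pos _ (allFuns (nv Γ) (nv Γ))
  (Any.map (count-pos (isMorph Γ Γ _) _) (isomorphism-listed Γ Γ id id (proj₂ (proj₂ (≅-refl Γ)))))

fin1-unique : (x y : Fin 1) → x ≡ y
fin1-unique zero zero = refl

autCount-corolla : (gen : Fin 1 → ℕ) (vert : Fin n → Fin 1) (pair : Fin n → Fin n) →
                   pair ≗ id → autCount (mkGraph 1 n gen vert pair) ≡ n !
autCount-corolla {n} gen vert pair legs =
  +-identityʳ _ ⟨ trans ⟩ count-cong _ bijᵇ (allFuns n n) isMorph≡bijᵇ ⟨ trans ⟩ count-bijections n
  where
  Γ = mkGraph 1 n gen vert pair
  α₀ : Fin 1 → Fin 1
  α₀ = consF zero (λ ())
  isMorph≡bijᵇ : ∀ β → isMorph Γ Γ α₀ β ≡ bijᵇ β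
  isMorph≡bijᵇ β = T-ext
    (λ t → let i = isMorph⁻ Γ Γ α₀ β t in from T-∧ (injᵇ⁺ β (β-injective i) , surjᵇ⁺ β (β-onto i)))
    (λ t → let (inj , surj) = to T-∧ t in isMorph⁺ Γ Γ α₀ β record
       { α-injective = λ _ → fin1-unique _ _ ; α-onto = λ y → y , fin1-unique _ _
       ; β-injective = injᵇ⁻ β inj ; β-onto = surjᵇ⁻ β surj
       ; genus-pres = λ _ → cong gen (fin1-unique _ _) ; vert-pres = λ _ → fin1-unique _ _
       ; pair-pres = λ h → legs (β h) ⟨ trans ⟩ cong β (sym (legs h)) })

≅Vgn⇒legs : ∀ {Γ g n} → Γ ≅ Vgn g n → pair Γ ≗ id
≅Vgn⇒legs (_ , β , i) h = sym (β-injective i (pair-pres i h))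

autCount-≅Vgn : ∀ {Γ g n} → Γ ≅ Vgn g n → autCount Γ ≡ n !
autCount-≅Vgn {Γ} iso = go Γ (≅⇒nv≡ iso) (≅⇒nh≡ iso) (≅Vgn⇒legs iso)
  where
  go : ∀ Γ {n} → nv Γ ≡ 1 → nh Γ ≡ n → pair Γ ≗ id → autCount Γ ≡ n !
  go (mkGraph _ _ gen vert pair) refl refl legs = autCount-corolla gen vert pair legs

corolla-≅Vgn : ∀ Γ {g n} → nv Γ ≡ 1 → nh Γ ≡ n → pair Γ ≗ id → genusSum Γ ≡ g → Γ ≅ Vgn g n
corolla-≅Vgn (mkGraph _ _ gen vert pair) refl refl legs genus≡g = id , id , record
  { α-injective = id ; α-onto = λ y → y , refl ; β-injective = id ; β-onto = λ y → y , refl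
  ; genus-pres = λ { zero → sym (sym (+-identityʳ _) ⟨ trans ⟩ genus≡g) }
  ; vert-pres = λ _ → fin1-unique _ _ ; pair-pres = λ h → sym (legs h) }

valence : (Fin k → Fin n) → Fin n → ℕ
valence vert v = sum (λ h → χ (vert h == v))

IsStable : (Fin n → ℕ) → (Fin k → Fin n) → Set
IsStable gen vert = ∀ v → 3 ≤ 2 * gen v + valence vert v

IsInvolutive : Graph → Set
IsInvolutive Γ = ∀ h → pair Γ (pair Γ h) ≡ h

isEdgeRep : (Γ : Graph) → Fin (nh Γ) → Bool
isEdgeRep Γ h = toℕ h <ᵇ toℕ (pair Γ h)

val≡valence : ∀ Γ v → val Γ v ≡ valence (vert Γ) v
val≡valence Γ v = count-allFin (λ h → vert Γ h == v)

genusSum≡sum : ∀ Γ → genusSum Γ ≡ sum (genus Γ)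
genusSum≡sum Γ = sumℕ-tabulate (genus Γ) id

χ-trichotomy : (x y : Fin n) → χ (toℕ x <ᵇ toℕ y) + χ (toℕ y <ᵇ toℕ x) + χ (y == x) ≡ 1
χ-trichotomy x y with <-cmp (toℕ x) (toℕ y)
... | tri< x<y x≢y _ =
  cong₂ (λ a b → a + b + χ (y == x)) (χ-true (<⇒<ᵇ x<y)) (χ-false (<-asym x<y ∘ <ᵇ⇒< _ _))
  ⟨ trans ⟩ cong suc (χ-false (x≢y ∘ cong toℕ ∘ sym ∘ ==⇒≡))
... | tri≈ x≮y x≡y y≮x =
  cong₂ (λ a b → a + b + χ (y == x)) (χ-false (x≮y ∘ <ᵇ⇒< _ _)) (χ-false (y≮x ∘ <ᵇ⇒< _ _))
  ⟨ trans ⟩ χ-true (≡⇒== (sym (toℕ-injective x≡y)))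
... | tri> _ x≢y y<x =
  cong₂ (λ a b → a + b + χ (y == x)) (χ-false (<-asym y<x ∘ <ᵇ⇒< _ _)) (χ-true (<⇒<ᵇ y<x))
  ⟨ trans ⟩ cong suc (χ-false (x≢y ∘ cong toℕ ∘ sym ∘ ==⇒≡))

-- Each half-edge h has exactly one of  h < pair h,  pair h < h,  pair h ≡ h,
-- and the involution  pair  swaps the first two classes.
double-edges+legs : ∀ Γ → IsInvolutive Γ → 2 * edgeCount Γ + legCount Γ ≡ nh Γ
double-edges+legs Γ invol = begin
  2 * edgeCount Γ + legCount Γ
    ≡⟨ cong₂ (λ e l → 2 * e + l) (count-allFin (isEdgeRep Γ)) (count-allFin (λ h → pair Γ h == h)) ⟩
  2 * E + L
    ≡⟨ cong (_+ L) (solve 1 (λ e → con 2 :* e := e :+ e) refl E ⟨ trans ⟩ cong (E +_) (sum-permute _ swap)) ⟩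
  E + sum (χ ∘ isEdgeRep Γ ∘ pair Γ) + L
    ≡⟨ cong (_+ L) (∑-distrib-+ (χ ∘ isEdgeRep Γ) (χ ∘ isEdgeRep Γ ∘ pair Γ)) ⟨
  sum (λ h → χ (isEdgeRep Γ h) + χ (isEdgeRep Γ (pair Γ h))) + L
    ≡⟨ ∑-distrib-+ (λ h → χ (isEdgeRep Γ h) + χ (isEdgeRep Γ (pair Γ h))) _ ⟨
  sum (λ h → χ (isEdgeRep Γ h) + χ (isEdgeRep Γ (pair Γ h)) + χ (pair Γ h == h))
    ≡⟨ sum-cong-≗ one-class ⟩
  sum {nh Γ} (λ _ → 1)
    ≡⟨ sum-one ⟩
  nh Γ ∎
  where
  open ≡-Reasoning
  E = sum (χ ∘ isEdgeRep Γ)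
  L = sum (λ h → χ (pair Γ h == h))
  one-class : ∀ h → χ (isEdgeRep Γ h) + χ (isEdgeRep Γ (pair Γ h)) + χ (pair Γ h == h) ≡ 1
  one-class h = cong (λ h′ → χ (isEdgeRep Γ h) + χ (toℕ (pair Γ h) <ᵇ toℕ h′) + χ (pair Γ h == h)) (invol h)
                ⟨ trans ⟩ χ-trichotomy h (pair Γ h)
  swap : Permutation (nh Γ) (nh Γ)
  swap = permutation (pair Γ) (pair Γ) invol invol

edgeCount-determined : ∀ Γ Δ → IsInvolutive Γ → IsInvolutive Δ → legCount Γ ≡ legCount Δ →
                       nh Γ ≡ 2 * k + nh Δ → edgeCount Γ ≡ k + edgeCount Δ
edgeCount-determined {k} Γ Δ invol-Γ invol-Δ legs≡ nh≡ = *-cancelˡ-≡ _ _ 2 (+-cancelʳ-≡ L _ _ (begin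
  2 * edgeCount Γ + L                    ≡⟨ cong (2 * edgeCount Γ +_) legs≡ ⟨
  2 * edgeCount Γ + legCount Γ           ≡⟨ double-edges+legs Γ invol-Γ ⟩
  nh Γ                                   ≡⟨ nh≡ ⟩
  2 * k + nh Δ                           ≡⟨ cong (2 * k +_) (double-edges+legs Δ invol-Δ) ⟨
  2 * k + (2 * edgeCount Δ + L)          ≡⟨ solve 3 (λ k e l → con 2 :* k :+ (con 2 :* e :+ l) := con 2 :* (k :+ e) :+ l)
                                                   refl k (edgeCount Δ) L ⟩
  2 * (k + edgeCount Δ) + L              ∎))
  where
  open ≡-Reasoning
  L = legCount Δ

-- Contracting one edge

removeFin-self : (i : Fin (suc n)) → removeFin i i ≡ nothing
removeFin-self i with i ≟ i
... | yes _   = refl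
... | no  i≢i = contradiction refl i≢i

removeFin-≢ : {i j : Fin (suc n)} (i≢j : i ≢ j) → removeFin i j ≡ just (punchOut i≢j)
removeFin-≢ {i = i} {j} i≢j with i ≟ j
... | yes i≡j = contradiction i≡j i≢j
... | no  _   = cong just (punchOut-cong i refl)

removeFin-punchIn : (i : Fin (suc n)) (x : Fin n) → removeFin i (punchIn i x) ≡ just x
removeFin-punchIn i x = removeFin-≢ (punchInᵢ≢i i x ∘ sym) ⟨ trans ⟩ cong just (punchOut-punchIn i)

removeFin-just : {i j : Fin (suc n)} {x : Fin n} → removeFin i j ≡ just x → j ≡ punchIn i x
removeFin-just {i = i} {j} e with i ≟ j
removeFin-just refl | no i≢j = sym (punchIn-punchOut i≢j)

removeFin-nothing : {i j : Fin (suc n)} → removeFin i j ≡ nothing → i ≡ j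
removeFin-nothing {i = i} {j} e with i ≟ j
removeFin-nothing _ | yes i≡j = i≡j

-- The two half-edges of the contracted edge sit at  merge va  and are about to be deleted,
-- hence the extra  2 * χ (merge va == w)  in  merged-stable.
record MergeSpec {nv nv′ k : ℕ} (gen : Fin nv → ℕ) (va vb : Fin nv) (vert : Fin k → Fin nv)
                 (gen′ : Fin nv′ → ℕ) (merge : Fin nv → Fin nv′) : Set where
  field
    merge-identifies : merge va ≡ merge vb
    merge-onto       : Onto merge
    merged-stable    : ∀ w → 3 + 2 * χ (merge va == w) ≤ 2 * gen′ w + valence (merge ∘ vert) w
    genus-balance    : sum gen′ + nv ≡ suc (sum gen + nv′)
    nonempty         : 1 ≤ nv′

loop-spec : (gen : Fin n → ℕ) {va vb : Fin n} (vert : Fin k → Fin n) → IsStable gen vert → va ≡ vb →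
            MergeSpec gen va vb vert (λ v → gen v + (if v == va then 1 else 0)) id
loop-spec {n} gen {va} vert stable va≡vb = record
  { merge-identifies = va≡vb
  ; merge-onto       = λ y → y , refl
  ; merged-stable    = merged-stable
  ; genus-balance    = cong (_+ n) (∑-distrib-+ gen _ ⟨ trans ⟩ cong (sum gen +_) (sum-single va 1)
                                    ⟨ trans ⟩ +-comm _ 1)
  ; nonempty         = ℕ.>-nonZero⁻¹ n {{nonZeroIndex va}}
  }
  where
  merged-stable : ∀ w → 3 + 2 * χ (va == w) ≤ 2 * (gen w + (if w == va then 1 else 0)) + valence vert w
  merged-stable w rewrite ==-sym va w with w == va
  ... | false = subst (λ g → 3 ≤ 2 * g + valence vert w) (sym (+-identityʳ (gen w))) (stable w)
  ... | true  = +-monoʳ-≤ 2 (stable w) ⟨ ≤-trans ⟩ ≤-reflexive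
      (solve 2 (λ g c → con 2 :+ (con 2 :* g :+ c) := con 2 :* (g :+ con 1) :+ c) refl (gen w) (valence vert w))

module _ (gen : Fin (suc m) → ℕ) {va vb : Fin (suc m)} (va≢vb : va ≢ vb) (vert : Fin k → Fin (suc m))
         (stable : IsStable gen vert) where

  private
    vb≢va : vb ≢ va
    vb≢va = va≢vb ∘ sym

    new : Fin m
    new = punchOut vb≢va

    merge : Fin (suc m) → Fin m
    merge u = fromMaybe new (removeFin vb u)

    gen′ : Fin m → ℕ
    gen′ w = gen (punchIn vb w) + (if w == new then gen vb else 0)

    merge-va : merge va ≡ new
    merge-va rewrite removeFin-≢ vb≢va = refl

    merge-vb : merge vb ≡ new
    merge-vb rewrite removeFin-self vb = refl

    fibre-new : ∀ u → χ (merge u == new) ≡ χ (u == va) + χ (u == vb)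
    fibre-new u with vb ≟ u
    ... | yes refl = cong χ (==-refl new) ⟨ trans ⟩
                     sym (cong₂ _+_ (χ-false (va≢vb ∘ sym ∘ ==⇒≡)) (χ-true (≡⇒== refl)))
    ... | no vb≢u =
      cong χ (T-ext (≡⇒== ∘ punchOut-injective vb≢u vb≢va ∘ ==⇒≡) (≡⇒== ∘ punchOut-cong vb ∘ ==⇒≡))
      ⟨ trans ⟩ sym (cong (χ (u == va) +_) (χ-false (vb≢u ∘ sym ∘ ==⇒≡)) ⟨ trans ⟩ +-identityʳ _)

    fibre-other : ∀ {w} → w ≢ new → ∀ u → χ (merge u == w) ≡ χ (u == punchIn vb w)
    fibre-other {w} w≢new u with vb ≟ u
    ... | yes refl =
      χ-false (w≢new ∘ sym ∘ ==⇒≡) ⟨ trans ⟩ sym (χ-false (punchInᵢ≢i vb w ∘ sym ∘ ==⇒≡))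
    ... | no vb≢u = cong χ (T-ext
      (λ t → ≡⇒== (sym (punchIn-punchOut vb≢u) ⟨ trans ⟩ cong (punchIn vb) (==⇒≡ t)))
      (λ t → ≡⇒== (punchOut-cong vb (==⇒≡ t) ⟨ trans ⟩ punchOut-punchIn vb)))

    stable-new : 3 + 2 * χ (merge va == new) ≤ 2 * gen′ new + valence (merge ∘ vert) new
    stable-new = begin
      3 + 2 * χ (merge va == new)
        ≡⟨ cong (λ b → 3 + 2 * χ b) (cong (_== new) merge-va ⟨ trans ⟩ ==-refl new) ⟩
      5 <⟨ n<1+n 5 ⟩
      3 + 3 ≤⟨ +-mono-≤ (stable va) (stable vb) ⟩
      (2 * gen va + valence vert va) + (2 * gen vb + valence vert vb)
        ≡⟨ solve 4 (λ a b c d → (con 2 :* a :+ c) :+ (con 2 :* b :+ d) := con 2 :* (a :+ b) :+ (c :+ d))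
                 refl (gen va) (gen vb) (valence vert va) (valence vert vb) ⟩
      2 * (gen va + gen vb) + (valence vert va + valence vert vb)
        ≡⟨ cong₂ (λ g c → 2 * g + c) gen′-new valence-new ⟨
      2 * gen′ new + valence (merge ∘ vert) new ∎
      where
      open ≤-Reasoning
      gen′-new : gen′ new ≡ gen va + gen vb
      gen′-new = cong₂ _+_ (cong gen (punchIn-punchOut vb≢va))
                           (cong (if_then gen vb else 0) (==-refl new))
      valence-new : valence (merge ∘ vert) new ≡ valence vert va + valence vert vb
      valence-new = sum-cong-≗ (fibre-new ∘ vert) ⟨ trans ⟩ ∑-distrib-+ (λ h → χ (vert h == va)) _

    stable-other : ∀ {w} → w ≢ new → 3 + 2 * χ (merge va == w) ≤ 2 * gen′ w + valence (merge ∘ vert) w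
    stable-other {w} w≢new = begin
      3 + 2 * χ (merge va == w)
        ≡⟨ cong (λ b → 3 + 2 * χ b) (cong (_== w) merge-va ⟨ trans ⟩ ≢⇒==-false (w≢new ∘ sym)) ⟩
      3 ≤⟨ stable (punchIn vb w) ⟩
      2 * gen (punchIn vb w) + valence vert (punchIn vb w)
        ≡⟨ cong₂ (λ g c → 2 * g + c) gen′-other (sum-cong-≗ (fibre-other w≢new ∘ vert)) ⟨
      2 * gen′ w + valence (merge ∘ vert) w ∎
      where
      open ≤-Reasoning
      gen′-other : gen′ w ≡ gen (punchIn vb w)
      gen′-other = cong (gen (punchIn vb w) +_) (cong (if_then gen vb else 0) (≢⇒==-false w≢new))
                   ⟨ trans ⟩ +-identityʳ _

  merge-spec : MergeSpec gen va vb vert gen′ merge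
  merge-spec = record
    { merge-identifies = merge-va ⟨ trans ⟩ sym merge-vb
    ; merge-onto       = λ w → punchIn vb w , cong (fromMaybe new) (removeFin-punchIn vb w)
    ; merged-stable    = merged-stable
    ; genus-balance    = cong (_+ suc m) genus-sum ⟨ trans ⟩ +-suc _ _
    ; nonempty         = ℕ.>-nonZero⁻¹ m {{nonZeroIndex new}}
    }
    where
    merged-stable : ∀ w → 3 + 2 * χ (merge va == w) ≤ 2 * gen′ w + valence (merge ∘ vert) w
    merged-stable w = by-cases (w ≟ new)
      where
      by-cases : Dec (w ≡ new) → 3 + 2 * χ (merge va == w) ≤ 2 * gen′ w + valence (merge ∘ vert) w
      by-cases (yes refl)  = stable-new
      by-cases (no  w≢new) = stable-other w≢new
    genus-sum : sum gen′ ≡ sum gen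
    genus-sum = ∑-distrib-+ (gen ∘ punchIn vb) _ ⟨ trans ⟩ cong (sum (gen ∘ punchIn vb) +_) (sum-single new (gen vb))
                ⟨ trans ⟩ +-comm _ (gen vb) ⟨ trans ⟩ sym (sum-remove {i = vb} gen)

mergeV-spec : ∀ nv (gen : Fin nv → ℕ) (va vb : Fin nv) (vert : Fin k → Fin nv) → IsStable gen vert →
              MergeSpec gen va vb vert (proj₁ (proj₂ (mergeV nv gen va vb))) (proj₂ (proj₂ (mergeV nv gen va vb)))
mergeV-spec nv gen va vb vert stable with va ≟ vb
... | yes va≡vb = loop-spec gen vert stable va≡vb
mergeV-spec (suc m) gen va vb vert stable | no va≢vb = merge-spec gen va≢vb vert stable

record ContractionSpec (Γ Γ′ : Graph) (a : Fin (nh Γ)) (survivor : Fin (nh Γ) → Maybe (Fin (nh Γ′))) : Set where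
  field
    old          : Fin (nh Γ′) → Fin (nh Γ)
    survivor-old : ∀ h′ → survivor (old h′) ≡ just h′
    old-covers   : ∀ h → h ≢ a → h ≢ pair Γ a → ∃ λ h′ → old h′ ≡ h
    sum-split    : ∀ f → sum f ≡ f a + f (pair Γ a) + sum (f ∘ old)
    old-pair     : ∀ h′ → old (pair Γ′ h′) ≡ pair Γ (old h′)
    merge        : Fin (nv Γ) → Fin (nv Γ′)
    vert-old     : ∀ h′ → vert Γ′ h′ ≡ merge (vert Γ (old h′))
    merging      : MergeSpec (genus Γ) (vert Γ a) (vert Γ (pair Γ a)) (vert Γ) (genus Γ′) merge

contractAux-spec : ∀ nv k gen vert (pr : Fin (2 + k) → Fin (2 + k)) a (b : Fin (suc k)) →
  pr a ≡ punchIn a b → (∀ h → pr (pr h) ≡ h) → IsStable gen vert →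
  ContractionSpec (mkGraph nv (2 + k) gen vert pr) (proj₁ (contractAux nv k gen vert pr a b)) a
                  (proj₂ (contractAux nv k gen vert pr a b))
contractAux-spec nv k gen vert pr a b pr-a invol stable = record
  { old          = old
  ; survivor-old = survivor-old
  ; old-covers   = old-covers
  ; sum-split    = sum-split
  ; old-pair     = old-pair
  ; merge        = proj₂ (proj₂ (mergeV nv gen (vert a) (vert (pr a))))
  ; vert-old     = λ _ → refl
  ; merging      = mergeV-spec nv gen (vert a) (vert (pr a)) vert stable
  }
  where
  survivor : Fin (2 + k) → Maybe (Fin k)
  survivor h = removeFin a h >>= removeFin b
  old : Fin k → Fin (2 + k)
  old h′ = punchIn a (punchIn b h′)
  survivor-old : ∀ h′ → survivor (old h′) ≡ just h′
  survivor-old h′ rewrite removeFin-punchIn a (punchIn b h′) = removeFin-punchIn b h′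
  old-covers : ∀ h → h ≢ a → h ≢ pr a → ∃ λ h′ → old h′ ≡ h
  old-covers h h≢a h≢pr-a = punchOut b≢x , (cong (punchIn a) (punchIn-punchOut b≢x) ⟨ trans ⟩ punchIn-punchOut a≢h)
    where
    a≢h = h≢a ∘ sym
    b≢x : b ≢ punchOut a≢h
    b≢x e = h≢pr-a (sym (punchIn-punchOut a≢h) ⟨ trans ⟩ cong (punchIn a) (sym e) ⟨ trans ⟩ sym pr-a)
  sum-split : ∀ f → sum f ≡ f a + f (pr a) + sum (f ∘ old)
  sum-split f rewrite pr-a =
    sum-remove {i = a} f ⟨ trans ⟩ cong (f a +_) (sum-remove {i = b} (f ∘ punchIn a)) ⟨ trans ⟩ sym (+-assoc (f a) _ _)
  old≢a : ∀ h′ → old h′ ≢ a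
  old≢a h′ = punchInᵢ≢i a _
  old≢pr-a : ∀ h′ → old h′ ≢ pr a
  old≢pr-a h′ e = punchInᵢ≢i b h′ (punchIn-injective a _ _ (e ⟨ trans ⟩ pr-a))
  old-pair : ∀ h′ → old (fromMaybe h′ (survivor (pr (old h′)))) ≡ pr (old h′)
  old-pair h′ with old-covers (pr (old h′)) (λ e → old≢pr-a h′ (sym (invol _) ⟨ trans ⟩ cong pr e))
                                           (λ e → old≢a h′ (sym (invol _) ⟨ trans ⟩ cong pr e ⟨ trans ⟩ invol a))
  ... | x , old-x≡ rewrite sym old-x≡ | survivor-old x = refl

contract1-spec : ∀ Γ a → pair Γ a ≢ a → IsInvolutive Γ → IsStable (genus Γ) (vert Γ) →
                 ContractionSpec Γ (proj₁ (contract1 Γ a)) a (proj₂ (contract1 Γ a))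
contract1-spec (mkGraph nv (suc k) gen vert pr) a pr-a≢a invol stable with removeFin a (pr a) in eq
... | nothing = contradiction (sym (removeFin-nothing eq)) pr-a≢a
contract1-spec (mkGraph nv (suc zero) gen vert pr) a _ _ _ | just ()
contract1-spec (mkGraph nv (suc (suc k)) gen vert pr) a _ invol stable | just b =
  contractAux-spec nv k gen vert pr a b (removeFin-just eq) invol stable

module Contraction {g n : ℕ} {Γ Γ′ : Graph} {a : Fin (nh Γ)} {survivor : Fin (nh Γ) → Maybe (Fin (nh Γ′))}
                   (G : InG g n Γ) (pair-a≢a : pair Γ a ≢ a) (spec : ContractionSpec Γ Γ′ a survivor) where

  open ContractionSpec spec
  open MergeSpec merging
  open InG G

  old-injective : Injective _≡_ _≡_ old
  old-injective {x} {y} e = just-injective (sym (survivor-old x) ⟨ trans ⟩ cong survivor e ⟨ trans ⟩ survivor-old y)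

  nh≡ : nh Γ ≡ 2 + nh Γ′
  nh≡ = sym sum-one ⟨ trans ⟩ sum-split (λ _ → 1) ⟨ trans ⟩ cong (2 +_) (sum-one {nh Γ′})

  involutive′ : IsInvolutive Γ′
  involutive′ h′ = old-injective (old-pair _ ⟨ trans ⟩ cong (pair Γ) (old-pair h′) ⟨ trans ⟩ involutive (old h′))

  legs′ : legCount Γ′ ≡ n
  legs′ = begin
    legCount Γ′                                        ≡⟨ count-allFin (λ h′ → pair Γ′ h′ == h′) ⟩
    sum (λ h′ → χ (pair Γ′ h′ == h′))                  ≡⟨ sum-cong-≗ (cong χ ∘ old-leg) ⟩
    sum (λ h′ → χ (pair Γ (old h′) == old h′))
      ≡⟨ cong₂ (λ x y → x + y + sum (λ h′ → χ (pair Γ (old h′) == old h′))) a-not-leg pair-a-not-leg ⟨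
    χ (pair Γ a == a) + χ (pair Γ (pair Γ a) == pair Γ a) + sum (λ h′ → χ (pair Γ (old h′) == old h′))
                                                       ≡⟨ sum-split (λ h → χ (pair Γ h == h)) ⟨
    sum (λ h → χ (pair Γ h == h))                      ≡⟨ count-allFin (λ h → pair Γ h == h) ⟨
    legCount Γ                                         ≡⟨ legs ⟩
    n                                                  ∎
    where
    open ≡-Reasoning
    old-leg : ∀ h′ → (pair Γ′ h′ == h′) ≡ (pair Γ (old h′) == old h′)
    old-leg h′ = T-ext (λ t → ≡⇒== (sym (old-pair h′) ⟨ trans ⟩ cong old (==⇒≡ t)))
                       (λ t → ≡⇒== (old-injective (old-pair h′ ⟨ trans ⟩ ==⇒≡ t)))
    a-not-leg : χ (pair Γ a == a) ≡ 0
    a-not-leg = χ-false (pair-a≢a ∘ ==⇒≡)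
    pair-a-not-leg : χ (pair Γ (pair Γ a) == pair Γ a) ≡ 0
    pair-a-not-leg = χ-false (λ t → pair-a≢a (sym (sym (involutive a) ⟨ trans ⟩ ==⇒≡ t)))

  edgeCount≡ : edgeCount Γ ≡ 1 + edgeCount Γ′
  edgeCount≡ = edgeCount-determined {k = 1} Γ Γ′ involutive involutive′ (legs ⟨ trans ⟩ sym legs′) nh≡

  stable′ : ∀ w → 3 ≤ 2 * genus Γ′ w + val Γ′ w
  stable′ w = +-cancelʳ-≤ (2 * x) 3 _ (merged-stable w ⟨ ≤-trans ⟩ ≤-reflexive valence-split)
    where
    x = χ (merge (vert Γ a) == w)
    valence-split : 2 * genus Γ′ w + valence (merge ∘ vert Γ) w ≡ 2 * genus Γ′ w + val Γ′ w + 2 * x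
    valence-split = begin
      2 * genus Γ′ w + valence (merge ∘ vert Γ) w
        ≡⟨ cong (2 * genus Γ′ w +_) (sum-split (λ h → χ (merge (vert Γ h) == w))) ⟩
      2 * genus Γ′ w + (x + χ (merge (vert Γ (pair Γ a)) == w) + sum (λ h′ → χ (merge (vert Γ (old h′)) == w)))
        ≡⟨ cong (λ v → 2 * genus Γ′ w + (x + χ (v == w) + sum (λ h′ → χ (merge (vert Γ (old h′)) == w))))
                merge-identifies ⟨
      2 * genus Γ′ w + (x + x + sum (λ h′ → χ (merge (vert Γ (old h′)) == w)))
        ≡⟨ cong (λ c → 2 * genus Γ′ w + (x + x + c))
                (sum-cong-≗ (λ h′ → cong (λ v → χ (v == w)) (vert-old h′))) ⟨
      2 * genus Γ′ w + (x + x + valence (vert Γ′) w)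
        ≡⟨ cong (λ c → 2 * genus Γ′ w + (x + x + c)) (val≡valence Γ′ w) ⟨
      2 * genus Γ′ w + (x + x + val Γ′ w)
        ≡⟨ solve 3 (λ G x v → G :+ (x :+ x :+ v) := G :+ v :+ con 2 :* x) refl (2 * genus Γ′ w) x (val Γ′ w) ⟩
      2 * genus Γ′ w + val Γ′ w + 2 * x ∎
      where open ≡-Reasoning

  totalGenus′ : edgeCount Γ′ + 1 + genusSum Γ′ ≡ g + nv Γ′
  totalGenus′ = +-cancelʳ-≡ (nv Γ) _ _ (begin
    edgeCount Γ′ + 1 + genusSum Γ′ + nv Γ
      ≡⟨ cong (λ s → edgeCount Γ′ + 1 + s + nv Γ) (genusSum≡sum Γ′) ⟩
    edgeCount Γ′ + 1 + sum (genus Γ′) + nv Γ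
      ≡⟨ +-assoc (edgeCount Γ′ + 1) _ _ ⟩
    edgeCount Γ′ + 1 + (sum (genus Γ′) + nv Γ)
      ≡⟨ cong (edgeCount Γ′ + 1 +_) genus-balance ⟩
    edgeCount Γ′ + 1 + suc (sum (genus Γ) + nv Γ′)
      ≡⟨ solve 3 (λ e G v → e :+ con 1 :+ (con 1 :+ (G :+ v)) := (con 1 :+ e) :+ con 1 :+ G :+ v)
               refl (edgeCount Γ′) (sum (genus Γ)) (nv Γ′) ⟩
    (1 + edgeCount Γ′) + 1 + sum (genus Γ) + nv Γ′
      ≡⟨ cong (λ e → e + 1 + sum (genus Γ) + nv Γ′) edgeCount≡ ⟨
    edgeCount Γ + 1 + sum (genus Γ) + nv Γ′
      ≡⟨ cong (λ s → edgeCount Γ + 1 + s + nv Γ′) (genusSum≡sum Γ) ⟨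
    edgeCount Γ + 1 + genusSum Γ + nv Γ′
      ≡⟨ cong (_+ nv Γ′) totalGenus ⟩
    g + nv Γ + nv Γ′
      ≡⟨ solve 3 (λ g a b → g :+ a :+ b := g :+ b :+ a) refl g (nv Γ) (nv Γ′) ⟩
    g + nv Γ′ + nv Γ ∎)
    where open ≡-Reasoning

  connected′ : Connected Γ′
  connected′ = nonempty , λ S hyp u′ w′ →
    let (u , merge-u≡u′) = merge-onto u′ ; (w , merge-w≡w′) = merge-onto w′
    in sym (cong S merge-u≡u′) ⟨ trans ⟩ proj₂ connected (S ∘ merge) (pulled-back S hyp) u w
       ⟨ trans ⟩ cong S merge-w≡w′
    where
    pulled-back : (S : Fin (nv Γ′) → Bool) → (∀ h′ → S (vert Γ′ h′) ≡ S (vert Γ′ (pair Γ′ h′))) →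
                  ∀ h → S (merge (vert Γ h)) ≡ S (merge (vert Γ (pair Γ h)))
    pulled-back S hyp h with h ≟ a
    ... | yes refl = cong S merge-identifies
    ... | no h≢a with h ≟ pair Γ a
    ... | yes refl = cong S (sym merge-identifies ⟨ trans ⟩ cong (merge ∘ vert Γ) (sym (involutive a)))
    ... | no h≢pair-a = let (h′ , old-h′≡h) = old-covers h h≢a h≢pair-a in
      subst (λ h → S (merge (vert Γ h)) ≡ S (merge (vert Γ (pair Γ h)))) old-h′≡h
        (cong S (sym (vert-old h′)) ⟨ trans ⟩ hyp h′ ⟨ trans ⟩
         cong S (vert-old (pair Γ′ h′) ⟨ trans ⟩ cong (merge ∘ vert Γ) (old-pair h′)))

  contracted-InG : InG g n Γ′
  contracted-InG = record
    { involutive = involutive′ ; stable = stable′ ; connected = connected′ ; legs = legs′ ; totalGenus = totalGenus′ }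

-- Contracting a set of edges

data DistinctEdges (Γ : Graph) : List (Fin (nh Γ)) → Set where
  []   : DistinctEdges Γ []
  cons : ∀ {x xs} → pair Γ x ≢ x → All (λ y → y ≢ x × y ≢ pair Γ x) xs → DistinctEdges Γ xs →
         DistinctEdges Γ (x ∷ xs)

InG⇒IsStable : ∀ {g n Γ} → InG g n Γ → IsStable (genus Γ) (vert Γ)
InG⇒IsStable {Γ = Γ} G v = subst (λ c → 3 ≤ 2 * genus Γ v + c) (val≡valence Γ v) (InG.stable G v)

module _ {Γ Γ′ : Graph} {a : Fin (nh Γ)} {survivor : Fin (nh Γ) → Maybe (Fin (nh Γ′))}
         (spec : ContractionSpec Γ Γ′ a survivor) where

  open ContractionSpec spec

  survivors : ∀ xs → All (λ y → y ≢ a × y ≢ pair Γ a) xs →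
              ∃ λ ys → mapMaybe survivor xs ≡ ys × map old ys ≡ xs
  survivors []       []                = [] , refl , refl
  survivors (y ∷ xs) ((y≢a , y≢pa) ∷ avoid) with old-covers y y≢a y≢pa | survivors xs avoid
  ... | y′ , refl | ys , mapMaybe≡ , map≡ rewrite survivor-old y′ =
    y′ ∷ ys , cong (y′ ∷_) mapMaybe≡ , cong (old y′ ∷_) map≡

  DistinctEdges-old⁻ : ∀ ys → DistinctEdges Γ (map old ys) → DistinctEdges Γ′ ys
  DistinctEdges-old⁻ []       _                  = []
  DistinctEdges-old⁻ (y ∷ ys) (cons y-edge avoid d) =
    cons (λ e → y-edge (sym (old-pair y) ⟨ trans ⟩ cong old e))
         (avoid′ ys avoid)
         (DistinctEdges-old⁻ ys d)
    where
    avoid′ : ∀ zs → All (λ z → z ≢ old y × z ≢ pair Γ (old y)) (map old zs) →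
             All (λ z → z ≢ y × z ≢ pair Γ′ y) zs
    avoid′ []       []                = []
    avoid′ (z ∷ zs) ((z≢y , z≢py) ∷ r) =
      ((z≢y ∘ cong old) , (λ e → z≢py (cong old e ⟨ trans ⟩ old-pair y))) ∷ avoid′ zs r

contractL-spec : ∀ {g n} f Γ E → f ≡ length E → InG g n Γ → DistinctEdges Γ E →
                 InG g n (contractL f Γ E) × nh Γ ≡ 2 * length E + nh (contractL f Γ E)
contractL-spec f Γ [] _ G _ = G , refl
contractL-spec (suc f) Γ (a ∷ as) f≡ G (cons pair-a≢a avoid d)
  with survivors (contract1-spec Γ a pair-a≢a (InG.involutive G) (InG⇒IsStable G)) as avoid
... | ys , mapMaybe≡ , map≡ rewrite mapMaybe≡ =
  proj₁ IH , (Contraction.nh≡ G pair-a≢a spec ⟨ trans ⟩ cong (2 +_) (proj₂ IH) ⟨ trans ⟩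
              cong (λ l → 2 + (2 * l + _)) |ys|≡ ⟨ trans ⟩
              solve 2 (λ l x → con 2 :+ (con 2 :* l :+ x) := con 2 :* (con 1 :+ l) :+ x) refl (length as) _)
  where
  spec = contract1-spec Γ a pair-a≢a (InG.involutive G) (InG⇒IsStable G)
  |ys|≡ : length ys ≡ length as
  |ys|≡ = sym (length-map _ ys) ⟨ trans ⟩ cong length map≡
  IH = contractL-spec f _ ys (ℕ.suc-injective f≡ ⟨ trans ⟩ sym |ys|≡) (Contraction.contracted-InG G pair-a≢a spec)
         (DistinctEdges-old⁻ spec ys (subst (DistinctEdges Γ) (sym map≡) d))

record Contracts (g n : ℕ) (Γ Δ : Graph) (e : ℕ) : Set where
  field
    contracted-InG : InG g n Δ
    nh-drop        : nh Γ ≡ 2 * e + nh Δ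
    edgeCount-drop : edgeCount Γ ≡ e + edgeCount Δ

contractSet-spec : ∀ {g n} Γ E → InG g n Γ → DistinctEdges Γ E → Contracts g n Γ (contractSet Γ E) (length E)
contractSet-spec Γ E G d = record
  { contracted-InG = G′
  ; nh-drop        = nh-drop
  ; edgeCount-drop = edgeCount-determined Γ (contractSet Γ E) (InG.involutive G) (InG.involutive G′)
                       (InG.legs G ⟨ trans ⟩ sym (InG.legs G′)) nh-drop
  }
  where
  G′ = proj₁ (contractL-spec (length E) Γ E refl G d)
  nh-drop = proj₂ (contractL-spec (length E) Γ E refl G d)

edgeReps-distinct : ∀ Γ → IsInvolutive Γ → DistinctEdges Γ (edgeReps Γ)
edgeReps-distinct Γ invol = go id (λ e → e)
  where
  rep-not-leg : ∀ {x} → T (isEdgeRep Γ x) → pair Γ x ≢ x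
  rep-not-leg t e = <-irrefl (cong toℕ (sym e)) (<ᵇ⇒< _ _ t)
  reps-not-paired : ∀ {x y} → T (isEdgeRep Γ x) → T (isEdgeRep Γ y) → y ≢ pair Γ x
  reps-not-paired {x} tx ty refl =
    <-asym (<ᵇ⇒< _ _ tx) (subst (λ z → toℕ (pair Γ x) < toℕ z) (invol x) (<ᵇ⇒< _ _ ty))
  filter-All : ∀ {P : Fin (nh Γ) → Set} (f : Fin k → Fin (nh Γ)) → (∀ i → T (isEdgeRep Γ (f i)) → P (f i)) →
               All P (filterᵇ (isEdgeRep Γ) (tabulate f))
  filter-All {zero}  f h = []
  filter-All {suc k} f h with isEdgeRep Γ (f zero) in eq
  ... | true  = h zero (from T-≡ eq) ∷ filter-All (f ∘ suc) (h ∘ suc)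
  ... | false = filter-All (f ∘ suc) (h ∘ suc)
  go : (f : Fin k → Fin (nh Γ)) → Injective _≡_ _≡_ f → DistinctEdges Γ (filterᵇ (isEdgeRep Γ) (tabulate f))
  go {zero}  f inj = []
  go {suc k} f inj with isEdgeRep Γ (f zero) in eq
  ... | true  = cons (rep-not-leg (from T-≡ eq))
                     (filter-All (f ∘ suc) (λ i t → (λ e → 0≢suc (inj e)) , reps-not-paired (from T-≡ eq) t))
                     (go (f ∘ suc) (suc-injective ∘ inj))
    where
    0≢suc : ∀ {i : Fin k} → suc i ≢ zero
    0≢suc ()
  ... | false = go (f ∘ suc) (suc-injective ∘ inj)

All-subsets : ∀ {P : A → Set} {xs} → All P xs → All (All P) (subsets xs)
All-subsets []         = [] ∷ []
All-subsets (px ∷ pxs) = All.++⁺ (All-subsets pxs) (All.map⁺ (All.map (px ∷_) (All-subsets pxs)))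

DistinctEdges-subsets : ∀ {Γ xs} → DistinctEdges Γ xs → All (DistinctEdges Γ) (subsets xs)
DistinctEdges-subsets []                   = [] ∷ []
DistinctEdges-subsets (cons x-edge avoid d) =
  All.++⁺ IH (All.map⁺ (All.zipWith (λ (dE , avoidE) → cons x-edge avoidE dE) (IH , All-subsets avoid)))
  where IH = DistinctEdges-subsets d

sum≡0⇒≡0 : {f : Fin n → ℕ} → sum f ≡ 0 → ∀ i → f i ≡ 0
sum≡0⇒≡0 {suc n} {f} e zero    = m+n≡0⇒m≡0 (f zero) e
sum≡0⇒≡0 {suc n} {f} e (suc i) = sum≡0⇒≡0 (m+n≡0⇒n≡0 (f zero) e) i

χ≡1⇒T : ∀ {b} → χ b ≡ 1 → T b
χ≡1⇒T {true} _ = tt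

no-edges⇒legs : ∀ Γ → IsInvolutive Γ → edgeCount Γ ≡ 0 → pair Γ ≗ id
no-edges⇒legs Γ invol no-edges h = ==⇒≡ (χ≡1⇒T (sym (cong₂ (λ x y → x + y + χ (pair Γ h == h))
    (not-rep h) (subst (λ h′ → χ (toℕ (pair Γ h) <ᵇ toℕ h′) ≡ 0) (invol h) (not-rep (pair Γ h))))
  ⟨ trans ⟩ χ-trichotomy h (pair Γ h)))
  where
  not-rep : ∀ h → χ (isEdgeRep Γ h) ≡ 0
  not-rep = sum≡0⇒≡0 (sym (count-allFin (isEdgeRep Γ)) ⟨ trans ⟩ no-edges)

legs-only⇒one-vertex : ∀ Γ → Connected Γ → pair Γ ≗ id → nv Γ ≡ 1
legs-only⇒one-vertex Γ (nonempty , constant) legs =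
  ≤-antisym (injective⇒≤ {f = λ _ → zero} (λ {u} {w} _ → all-equal u w)) nonempty
  where
  all-equal : ∀ u w → u ≡ w
  all-equal u w = sym (==⇒≡ (from T-≡ (sym (constant (_== u) edges-trivial u w) ⟨ trans ⟩ ==-refl u)))
    where
    edges-trivial : ∀ h → (vert Γ h == u) ≡ (vert Γ (pair Γ h) == u)
    edges-trivial h = cong (λ h′ → vert Γ h′ == u) (sym (legs h))

full-contraction-≅Vgn : ∀ {g n} Γ → InG g n Γ → contractSet Γ (edgeReps Γ) ≅ Vgn g n
full-contraction-≅Vgn {g} {n} Γ G = corolla-≅Vgn X one-vertex nh≡n legs-only genusSum≡g
  where
  open Contracts (contractSet-spec Γ (edgeReps Γ) G (edgeReps-distinct Γ (InG.involutive G)))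
  X = contractSet Γ (edgeReps Γ)
  GX = contracted-InG
  no-edges : edgeCount X ≡ 0
  no-edges = sym (+-cancelˡ-≡ (edgeCount Γ) 0 _ (+-identityʳ _ ⟨ trans ⟩ edgeCount-drop))
  nh≡n : nh X ≡ n
  nh≡n = sym (double-edges+legs X (InG.involutive GX)) ⟨ trans ⟩ cong₂ (λ e l → 2 * e + l) no-edges (InG.legs GX)
  legs-only = no-edges⇒legs X (InG.involutive GX) no-edges
  one-vertex = legs-only⇒one-vertex X (InG.connected GX) legs-only
  genusSum≡g : genusSum X ≡ g
  genusSum≡g = +-cancelʳ-≡ 1 _ _ (+-comm _ 1 ⟨ trans ⟩ cong (λ e → e + 1 + genusSum X) (sym no-edges)
                                  ⟨ trans ⟩ InG.totalGenus GX ⟨ trans ⟩ cong (g +_) one-vertex)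

subsets-complete : (xs : List A) → Any (_≡ xs) (subsets xs)
subsets-complete []       = here refl
subsets-complete (x ∷ xs) = Any.++⁺ʳ (subsets xs) (Any.map⁺ (Any.map (cong (x ∷_)) (subsets-complete xs)))

leqᵇ⁺ : ∀ Γ Δ → 1 ≤ cCount Γ Δ → T (leqᵇ Γ Δ)
leqᵇ⁺ Γ Δ _ with cCount Γ Δ
... | suc _ = tt

leqᵇ⁻ : ∀ Γ Δ → T (leqᵇ Γ Δ) → 1 ≤ cCount Γ Δ
leqᵇ⁻ Γ Δ _ with cCount Γ Δ
... | suc _ = s≤s z≤n

leqᵇ-Vgn : ∀ {g n} Γ → InG g n Γ → T (leqᵇ Γ (Vgn g n))
leqᵇ-Vgn {g} {n} Γ G = leqᵇ⁺ Γ (Vgn g n) (count-pos (λ E → isoᵇ (contractSet Γ E) (Vgn g n)) (subsets (edgeReps Γ))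
  (Any.map (λ { refl → isoᵇ⁺ _ (Vgn g n) (full-contraction-≅Vgn Γ G) }) (subsets-complete (edgeReps Γ))))

nonempty-contraction-nh : ∀ {g n} Γ x E → InG g n Γ → DistinctEdges Γ (x ∷ E) →
                          2 + nh (contractSet Γ (x ∷ E)) ≤ nh Γ
nonempty-contraction-nh Γ x E G d = begin
  2 + nh (contractSet Γ (x ∷ E))                   ≤⟨ +-monoˡ-≤ _ (*-monoʳ-≤ 2 (s≤s (z≤n {length E}))) ⟩
  2 * length (x ∷ E) + nh (contractSet Γ (x ∷ E))  ≡⟨ Contracts.nh-drop (contractSet-spec Γ (x ∷ E) G d) ⟨
  nh Γ                                             ∎
  where open ≤-Reasoning

proper-contraction-nh : ∀ {g n} Γ Δ E → InG g n Γ → DistinctEdges Γ E →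
                        T (isoᵇ (contractSet Γ E) Δ) → ¬ T (isoᵇ Γ Δ) → 2 + nh Δ ≤ nh Γ
proper-contraction-nh Γ Δ []      G d iso ¬iso = contradiction iso ¬iso
proper-contraction-nh Γ Δ (x ∷ E) G d iso _    =
  subst (λ k → 2 + k ≤ nh Γ) (≅⇒nh≡ (isoᵇ⁻ (contractSet Γ (x ∷ E)) Δ iso))
        (nonempty-contraction-nh Γ x E G d)

<⇒nh-drop : ∀ {g n} Γ Δ → InG g n Γ → T (leqᵇ Γ Δ) → ¬ T (isoᵇ Γ Δ) → 2 + nh Δ ≤ nh Γ
<⇒nh-drop Γ Δ G Γ≤Δ Γ≇Δ =
  let witness = count-pos⁻ (λ E → isoᵇ (contractSet Γ E) Δ) (subsets (edgeReps Γ)) (leqᵇ⁻ Γ Δ Γ≤Δ)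
      (distinct , iso) = All.lookupAny (DistinctEdges-subsets (edgeReps-distinct Γ (InG.involutive G))) witness
  in proper-contraction-nh Γ Δ (Any.lookup witness) G distinct iso Γ≇Δ

count-cong-All : ∀ {P : A → Set} (p q : A → Bool) {xs} → All P xs → (∀ {x} → P x → p x ≡ q x) →
                 count p xs ≡ count q xs
count-cong-All p q []                 e = refl
count-cong-All p q {x ∷ xs} (px ∷ pxs) e rewrite e px with q x
... | true  = cong suc (count-cong-All p q pxs e)
... | false = count-cong-All p q pxs e

count-null-subsets : (xs : List A) → count null (subsets xs) ≡ 1
count-null-subsets []       = refl
count-null-subsets (x ∷ xs) = count-++ null (subsets xs) _ ⟨ trans ⟩
  cong₂ _+_ (count-null-subsets xs) (count-map null (x ∷_) (subsets xs) ⟨ trans ⟩ count-false (subsets xs))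

cCount-≅ : ∀ {g n} Γ Δ → InG g n Γ → T (isoᵇ Γ Δ) → cCount Γ Δ ≡ 1
cCount-≅ Γ Δ G Γ≅Δ =
  count-cong-All (λ E → isoᵇ (contractSet Γ E) Δ) null
    (DistinctEdges-subsets (edgeReps-distinct Γ (InG.involutive G))) only-empty
  ⟨ trans ⟩ count-null-subsets (edgeReps Γ)
  where
  only-empty : ∀ {E} → DistinctEdges Γ E → isoᵇ (contractSet Γ E) Δ ≡ null E
  only-empty {[]}    _ = T⇒≡true Γ≅Δ
  only-empty {x ∷ E} d = ¬T⇒≡false λ Γ/E≅Δ →
    let Γ/E = contractSet Γ (x ∷ E)
        Γ/E≅Γ = isoᵇ⁻ Γ/E Γ (isoᵇ-trans Γ/E Δ Γ Γ/E≅Δ (isoᵇ-sym Γ Δ Γ≅Δ))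
    in 1+n≰n (n≤1+n _ ⟨ ≤-trans ⟩ subst (λ k → 2 + k ≤ nh Γ) (≅⇒nh≡ Γ/E≅Γ) (nonempty-contraction-nh Γ x E G d))

-- Signed sums over the representatives

sumℤ : List ℤ → ℤ
sumℤ = foldr ℤ._+_ 0ℤ

sumℤ-++ : (f : A → ℤ) (xs ys : List A) → sumℤ (map f (xs ++ ys)) ≡ sumℤ (map f xs) ℤ.+ sumℤ (map f ys)
sumℤ-++ f []       ys = sym (ℤ.+-identityˡ _)
sumℤ-++ f (x ∷ xs) ys = cong (ℤ._+_ (f x)) (sumℤ-++ f xs ys) ⟨ trans ⟩ sym (ℤ.+-assoc (f x) _ _)

sumℤ-*ˡ : (c : ℤ) (f : A → ℤ) (xs : List A) → sumℤ (map (λ x → c ℤ.* f x) xs) ≡ c ℤ.* sumℤ (map f xs)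
sumℤ-*ˡ c f []       = sym (ℤ.*-zeroʳ c)
sumℤ-*ˡ c f (x ∷ xs) = cong (ℤ._+_ (c ℤ.* f x)) (sumℤ-*ˡ c f xs) ⟨ trans ⟩ sym (ℤ.*-distribˡ-+ c (f x) _)

sumℤ-+ : (f g : A → ℤ) (xs : List A) →
         sumℤ (map (λ x → f x ℤ.+ g x) xs) ≡ sumℤ (map f xs) ℤ.+ sumℤ (map g xs)
sumℤ-+ f g []       = refl
sumℤ-+ f g (x ∷ xs) = cong (ℤ._+_ (f x ℤ.+ g x)) (sumℤ-+ f g xs) ⟨ trans ⟩
  ℤ+.interchange (f x) (g x) (sumℤ (map f xs)) (sumℤ (map g xs))

sumℤ-zero : (xs : List A) → sumℤ (map (λ _ → 0ℤ) xs) ≡ 0ℤ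
sumℤ-zero []       = refl
sumℤ-zero (x ∷ xs) = ℤ.+-identityˡ _ ⟨ trans ⟩ sumℤ-zero xs

sumℤ-swap : (F : A → B → ℤ) (xs : List A) (ys : List B) →
  sumℤ (map (λ x → sumℤ (map (F x) ys)) xs) ≡ sumℤ (map (λ y → sumℤ (map (λ x → F x y) xs)) ys)
sumℤ-swap F []       ys = sym (sumℤ-zero ys)
sumℤ-swap F (x ∷ xs) ys = cong (ℤ._+_ (sumℤ (map (F x) ys))) (sumℤ-swap F xs ys) ⟨ trans ⟩
  sym (sumℤ-+ (F x) (λ y → sumℤ (map (λ x → F x y) xs)) ys)

sumℤ-if : (p : A → Bool) (c : ℤ) (xs : List A) →
          sumℤ (map (λ x → if p x then c else 0ℤ) xs) ≡ ℤ.+ count p xs ℤ.* c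
sumℤ-if p c []       = refl
sumℤ-if p c (x ∷ xs) with p x
... | true  = cong (ℤ._+_ c) (sumℤ-if p c xs) ⟨ trans ⟩
              sym (ℤ.*-distribʳ-+ c 1ℤ (ℤ.+ count p xs) ⟨ trans ⟩
                   cong (ℤ._+ (ℤ.+ count p xs ℤ.* c)) (ℤ.*-identityˡ c))
... | false = ℤ.+-identityˡ _ ⟨ trans ⟩ sumℤ-if p c xs

map-cong-All : ∀ {P : A → Set} {f g : A → B} {xs} → All P xs → (∀ {x} → P x → f x ≡ g x) →
               map f xs ≡ map g xs
map-cong-All pxs e = map-cong-local (All.map e pxs)

sign : ℕ → ℤ
sign k = -1ℤ ℤ.^ k

sign-square : ∀ k → sign k ℤ.* sign k ≡ 1ℤ
sign-square k = sym (ℤ.^-distribˡ-+-* -1ℤ k k) ⟨ trans ⟩ cong sign (cong (k +_) (sym (+-identityʳ k)))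
                ⟨ trans ⟩ sym (ℤ.^-*-assoc -1ℤ 2 k) ⟨ trans ⟩ ℤ.^-zeroˡ k

sign-drop : ∀ k l → sign l ≡ sign (k + l) ℤ.* sign k
sign-drop k l = sym (begin
  sign (k + l) ℤ.* sign k          ≡⟨ cong (ℤ._* sign k) (ℤ.^-distribˡ-+-* -1ℤ k l) ⟩
  sign k ℤ.* sign l ℤ.* sign k     ≡⟨ cong (ℤ._* sign k) (ℤ.*-comm (sign k) (sign l)) ⟩
  sign l ℤ.* sign k ℤ.* sign k     ≡⟨ ℤ.*-assoc (sign l) _ _ ⟩
  sign l ℤ.* (sign k ℤ.* sign k)   ≡⟨ cong (sign l ℤ.*_) (sign-square k) ⟩
  sign l ℤ.* 1ℤ                    ≡⟨ ℤ.*-identityʳ (sign l) ⟩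
  sign l                           ∎)
  where open ≡-Reasoning

alternating-subsets : (x : A) (xs : List A) → sumℤ (map (sign ∘ length) (subsets (x ∷ xs))) ≡ 0ℤ
alternating-subsets x xs = begin
  sumℤ (map (sign ∘ length) (subsets xs ++ map (x ∷_) (subsets xs)))
    ≡⟨ sumℤ-++ (sign ∘ length) (subsets xs) _ ⟩
  S ℤ.+ sumℤ (map (sign ∘ length) (map (x ∷_) (subsets xs)))
    ≡⟨ cong (λ ys → S ℤ.+ sumℤ ys) (map-∘ (subsets xs)) ⟨
  S ℤ.+ sumℤ (map (λ E → -1ℤ ℤ.* sign (length E)) (subsets xs))
    ≡⟨ cong (ℤ._+_ S) (sumℤ-*ˡ -1ℤ (sign ∘ length) (subsets xs) ⟨ trans ⟩ ℤ.-1*i≡-i S) ⟩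
  S ℤ.- S
    ≡⟨ ℤ.+-inverseʳ S ⟩
  0ℤ ∎
  where
  open ≡-Reasoning
  S = sumℤ (map (sign ∘ length) (subsets xs))

count-none : (p : A → Bool) (xs : List A) → (∀ j → ¬ T (p (lookup xs j))) → count p xs ≡ 0
count-none p []       _    = refl
count-none p (x ∷ xs) none with p x in eq
... | true  = contradiction (from T-≡ eq) (none zero)
... | false = count-none p xs (none ∘ suc)

count-unique : (p : A → Bool) (xs : List A) → Any (T ∘ p) xs →
               (∀ i j → T (p (lookup xs i)) → T (p (lookup xs j)) → i ≡ j) → count p xs ≡ 1
count-unique p (x ∷ xs) some unique with p x in eq
... | true  = cong suc (count-none p xs (λ j t → 0≢suc (unique zero (suc j) (from T-≡ eq) t)))
  where
  0≢suc : ∀ {j : Fin (length xs)} → zero ≢ suc j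
  0≢suc ()
count-unique p (x ∷ xs) (here t)     unique | false = contradiction (subst T eq t) id
count-unique p (x ∷ xs) (there some) unique | false =
  count-unique p xs some (λ i j ti tj → suc-injective (unique (suc i) (suc j) ti tj))

edgeCount-≅ : ∀ {g n Γ Δ} → InG g n Γ → InG g n Δ → Γ ≅ Δ → edgeCount Γ ≡ edgeCount Δ
edgeCount-≅ {Γ = Γ} {Δ} GΓ GΔ iso = edgeCount-determined {k = 0} Γ Δ (InG.involutive GΓ) (InG.involutive GΔ)
  (InG.legs GΓ ⟨ trans ⟩ sym (InG.legs GΔ)) (≅⇒nh≡ iso)

module Representatives {g n : ℕ} {L : List Graph} (R : IsRepList g n L) where

  members-InG : All (InG g n) L
  members-InG = proj₁ R

  count-class : ∀ X → InG g n X → count (isoᵇ X) L ≡ 1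
  count-class X G = count-unique (isoᵇ X) L (proj₁ (proj₂ R) X G) λ i j X≅i X≅j →
    proj₂ (proj₂ R) i j (isoᵇ-trans (lookup L i) X (lookup L j) (isoᵇ-sym X (lookup L i) X≅i) X≅j)

  sum-class : ∀ X → InG g n X → (f : Graph → ℤ) → (∀ {y} → InG g n y → T (isoᵇ X y) → f y ≡ f X) →
              sumℤ (map (λ y → if isoᵇ X y then f y else 0ℤ) L) ≡ f X
  sum-class X G f invariant = begin
    sumℤ (map (λ y → if isoᵇ X y then f y else 0ℤ) L) ≡⟨ cong sumℤ (map-cong-All members-InG on-class) ⟩
    sumℤ (map (λ y → if isoᵇ X y then f X else 0ℤ) L) ≡⟨ sumℤ-if (isoᵇ X) (f X) L ⟩
    ℤ.+ count (isoᵇ X) L ℤ.* f X                      ≡⟨ cong (λ c → ℤ.+ c ℤ.* f X) (count-class X G) ⟩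
    1ℤ ℤ.* f X                                       ≡⟨ ℤ.*-identityˡ (f X) ⟩
    f X                                              ∎
    where
    open ≡-Reasoning
    on-class : ∀ {y} → InG g n y → (if isoᵇ X y then f y else 0ℤ) ≡ (if isoᵇ X y then f X else 0ℤ)
    on-class {y} Gy with isoᵇ X y in eq
    ... | true  = invariant Gy (from T-≡ eq)
    ... | false = refl

  sign-edges-invariant : ∀ X → InG g n X → ∀ {y} → InG g n y → T (isoᵇ X y) →
                         sign (edgeCount y) ≡ sign (edgeCount X)
  sign-edges-invariant X GX Gy X≅y = cong sign (sym (edgeCount-≅ GX Gy (isoᵇ⁻ X _ X≅y)))

module ContractionSum {g n : ℕ} {L : List Graph} (R : IsRepList g n L) {Γ : Graph} (G : InG g n Γ) where

  open Representatives R

  σ : Graph → ℤ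
  σ y = sign (edgeCount y)

  weighted : Graph → ℤ
  weighted y = ℤ.+ cCount Γ y ℤ.* σ y

  private
    S = subsets (edgeReps Γ)

    contraction-class : ∀ {E} → DistinctEdges Γ E →
      sumℤ (map (λ y → if isoᵇ (contractSet Γ E) y then σ y else 0ℤ) L) ≡ σ Γ ℤ.* sign (length E)
    contraction-class {E} d =
      sum-class X contracted-InG σ (sign-edges-invariant X contracted-InG) ⟨ trans ⟩
      sign-drop (length E) (edgeCount X) ⟨ trans ⟩ cong (λ e → sign e ℤ.* sign (length E)) (sym edgeCount-drop)
      where
      open Contracts (contractSet-spec Γ E G d)
      X = contractSet Γ E

  -- Each subset E of edges contributes exactly once, to the representative of Γ/E.
  weighted-sum : sumℤ (map weighted L) ≡ σ Γ ℤ.* sumℤ (map (sign ∘ length) S)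
  weighted-sum = begin
    sumℤ (map weighted L)
      ≡⟨ cong sumℤ (map-cong (λ y → sym (sumℤ-if (λ E → isoᵇ (contractSet Γ E) y) (σ y) S)) L) ⟩
    sumℤ (map (λ y → sumℤ (map (λ E → if isoᵇ (contractSet Γ E) y then σ y else 0ℤ) S)) L)
      ≡⟨ sumℤ-swap (λ y E → if isoᵇ (contractSet Γ E) y then σ y else 0ℤ) L S ⟩
    sumℤ (map (λ E → sumℤ (map (λ y → if isoᵇ (contractSet Γ E) y then σ y else 0ℤ) L)) S)
      ≡⟨ cong sumℤ (map-cong-All (DistinctEdges-subsets (edgeReps-distinct Γ (InG.involutive G))) contraction-class) ⟩
    sumℤ (map (λ E → σ Γ ℤ.* sign (length E)) S)
      ≡⟨ sumℤ-*ˡ (σ Γ) (sign ∘ length) S ⟩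
    σ Γ ℤ.* sumℤ (map (sign ∘ length) S) ∎
    where open ≡-Reasoning

  weighted-sum-vanishes : ¬ T (isoᵇ Γ (Vgn g n)) → sumℤ (map weighted L) ≡ 0ℤ
  weighted-sum-vanishes Γ≇V =
    weighted-sum ⟨ trans ⟩ cong (σ Γ ℤ.*_) (alternating refl) ⟨ trans ⟩ ℤ.*-zeroʳ (σ Γ)
    where
    alternating : ∀ {xs} → xs ≡ edgeReps Γ → sumℤ (map (sign ∘ length) (subsets xs)) ≡ 0ℤ
    alternating {[]}     no-edges = contradiction (isoᵇ⁺ Γ (Vgn g n)
      (subst (λ E → contractSet Γ E ≅ Vgn g n) (sym no-edges) (full-contraction-≅Vgn Γ G))) Γ≇V
    alternating {x ∷ xs} _        = alternating-subsets x xs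

  weighted-class : sumℤ (map (λ y → if isoᵇ Γ y then weighted y else 0ℤ) L) ≡ σ Γ
  weighted-class = sum-class Γ G weighted invariant ⟨ trans ⟩
                   cong (λ c → ℤ.+ c ℤ.* σ Γ) (cCount-≅ Γ Γ G Γ≅Γ) ⟨ trans ⟩ ℤ.*-identityˡ (σ Γ)
    where
    Γ≅Γ = isoᵇ⁺ Γ Γ (≅-refl Γ)
    invariant : ∀ {y} → InG g n y → T (isoᵇ Γ y) → weighted y ≡ weighted Γ
    invariant {y} Gy Γ≅y = cong₂ (λ c e → ℤ.+ c ℤ.* e)
      (cCount-≅ Γ y G Γ≅y ⟨ trans ⟩ sym (cCount-≅ Γ Γ G Γ≅Γ)) (sign-edges-invariant Γ G Gy Γ≅y)

  proper-weighted-sum : ¬ T (isoᵇ Γ (Vgn g n)) →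
                        sumℤ (map (λ y → if isoᵇ Γ y then 0ℤ else weighted y) L) ≡ ℤ.- σ Γ
  proper-weighted-sum Γ≇V =
    ℤ+-group.inverseˡ-unique _ _
      (sym (sumℤ-+ _ _ L) ⟨ trans ⟩ cong sumℤ (map-cong split L) ⟨ trans ⟩ weighted-sum-vanishes Γ≇V)
    ⟨ trans ⟩ cong ℤ.-_ weighted-class
    where
    split : ∀ y → (if isoᵇ Γ y then 0ℤ else weighted y) ℤ.+ (if isoᵇ Γ y then weighted y else 0ℤ) ≡ weighted y
    split y with isoᵇ Γ y
    ... | true  = ℤ.+-identityˡ (weighted y)
    ... | false = ℤ.+-identityʳ (weighted y)

fromℚᵘ-homo-* : ∀ p q → fromℚᵘ (p ℚᵘ.* q) ≡ fromℚᵘ p ℚ.* fromℚᵘ q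
fromℚᵘ-homo-* p q = ℚ.toℚᵘ-injective (begin
  toℚᵘ (fromℚᵘ (p ℚᵘ.* q))               ≈⟨ ℚ.toℚᵘ-fromℚᵘ (p ℚᵘ.* q) ⟩
  p ℚᵘ.* q                                ≈⟨ ℚᵘ.*-cong (ℚ.toℚᵘ-fromℚᵘ p) (ℚ.toℚᵘ-fromℚᵘ q) ⟨
  toℚᵘ (fromℚᵘ p) ℚᵘ.* toℚᵘ (fromℚᵘ q)   ≈⟨ ℚ.toℚᵘ-homo-* (fromℚᵘ p) (fromℚᵘ q) ⟨
  toℚᵘ (fromℚᵘ p ℚ.* fromℚᵘ q)           ∎)
  where open ℚᵘ.≃-Reasoning

fromℚᵘ-homo-+ : ∀ p q → fromℚᵘ (p ℚᵘ.+ q) ≡ fromℚᵘ p ℚ.+ fromℚᵘ q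
fromℚᵘ-homo-+ p q = ℚ.toℚᵘ-injective (begin
  toℚᵘ (fromℚᵘ (p ℚᵘ.+ q))               ≈⟨ ℚ.toℚᵘ-fromℚᵘ (p ℚᵘ.+ q) ⟩
  p ℚᵘ.+ q                                ≈⟨ ℚᵘ.+-cong (ℚ.toℚᵘ-fromℚᵘ p) (ℚ.toℚᵘ-fromℚᵘ q) ⟨
  toℚᵘ (fromℚᵘ p) ℚᵘ.+ toℚᵘ (fromℚᵘ q)   ≈⟨ ℚ.toℚᵘ-homo-+ (fromℚᵘ p) (fromℚᵘ q) ⟨
  toℚᵘ (fromℚᵘ p ℚ.+ fromℚᵘ q)           ∎)
  where open ℚᵘ.≃-Reasoning

fromℚᵘ-homo‿- : ∀ p → fromℚᵘ (ℚᵘ.- p) ≡ ℚ.- fromℚᵘ p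
fromℚᵘ-homo‿- p = ℚ.toℚᵘ-injective (begin
  toℚᵘ (fromℚᵘ (ℚᵘ.- p))   ≈⟨ ℚ.toℚᵘ-fromℚᵘ (ℚᵘ.- p) ⟩
  ℚᵘ.- p                   ≈⟨ ℚᵘ.-‿cong (ℚ.toℚᵘ-fromℚᵘ p) ⟨
  ℚᵘ.- toℚᵘ (fromℚᵘ p)     ≈⟨ ℚ.toℚᵘ-homo‿- (fromℚᵘ p) ⟨
  toℚᵘ (ℚ.- fromℚᵘ p)      ∎)
  where open ℚᵘ.≃-Reasoning

ι : ℤ → ℚ
ι z = fromℚᵘ (mkℚᵘ z 0)

ι-+ : ∀ a b → ι (a ℤ.+ b) ≡ ι a ℚ.+ ι b
ι-+ a b =
  ℚ.fromℚᵘ-cong {mkℚᵘ (a ℤ.+ b) 0} {mkℚᵘ a 0 ℚᵘ.+ mkℚᵘ b 0}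
    (*≡* (cong (ℤ._* 1ℤ) (cong₂ ℤ._+_ (sym (ℤ.*-identityʳ a)) (sym (ℤ.*-identityʳ b)))))
  ⟨ trans ⟩ fromℚᵘ-homo-+ (mkℚᵘ a 0) (mkℚᵘ b 0)

sumℚ-ι : (t : A → ℤ) (K : ℚ) (xs : List A) →
         sumℚ (map (λ x → ι (t x) ℚ.* K) xs) ≡ ι (sumℤ (map t xs)) ℚ.* K
sumℚ-ι t K []       = sym (ℚ.*-zeroˡ K)
sumℚ-ι t K (x ∷ xs) = cong (ι (t x) ℚ.* K ℚ.+_) (sumℚ-ι t K xs) ⟨ trans ⟩
  sym (ℚ.*-distribʳ-+ K (ι (t x)) _) ⟨ trans ⟩ cong (ℚ._* K) (sym (ι-+ (t x) _))

-- The automorphism count  A  of the intermediate graph cancels in  ζ̃ · μ̃.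
frac-*-cancel : ∀ A B c m s → 1 ≤ A → 1 ≤ B →
  frac (ℤ.+ (A * c)) B ℚ.* frac (s ℤ.* ℤ.+ m) A ≡ ι (ℤ.+ c ℤ.* s) ℚ.* frac (ℤ.+ m) B
frac-*-cancel (suc a) (suc b) c m s _ _ =
  sym (fromℚᵘ-homo-* (mkℚᵘ (ℤ.+ (suc a * c)) b) (mkℚᵘ (s ℤ.* ℤ.+ m) a)) ⟨ trans ⟩
  ℚ.fromℚᵘ-cong {mkℚᵘ (ℤ.+ (suc a * c)) b ℚᵘ.* mkℚᵘ (s ℤ.* ℤ.+ m) a}
                {mkℚᵘ (ℤ.+ c ℤ.* s) 0 ℚᵘ.* mkℚᵘ (ℤ.+ m) b} (*≡* cross) ⟨ trans ⟩
  fromℚᵘ-homo-* (mkℚᵘ (ℤ.+ c ℤ.* s) 0) (mkℚᵘ (ℤ.+ m) b)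
  where
  cross : ℤ.+ (suc a * c) ℤ.* (s ℤ.* ℤ.+ m) ℤ.* ℤ.+ (1 * suc b)
        ≡ ℤ.+ c ℤ.* s ℤ.* ℤ.+ m ℤ.* ℤ.+ (suc b * suc a)
  cross = cong₂ (λ u v → u ℤ.* (s ℤ.* ℤ.+ m) ℤ.* v) (ℤ.pos-* (suc a) c) (ℤ.pos-* 1 (suc b)) ⟨ trans ⟩
          ℤ*.solve 5 (λ A C S M B → ((A ⊕ C) ⊕ (S ⊕ M)) ⊕ (ℤ*.id ⊕ B) ⊜ ((C ⊕ S) ⊕ M) ⊕ (B ⊕ A)) refl
            (ℤ.+ suc a) (ℤ.+ c) s (ℤ.+ m) (ℤ.+ suc b) ⟨ trans ⟩
          cong (ℤ.+ c ℤ.* s ℤ.* ℤ.+ m ℤ.*_) (sym (ℤ.pos-* (suc b) (suc a)))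

ι-*-frac : ∀ B m s → 1 ≤ B → ι s ℚ.* frac (ℤ.+ m) B ≡ frac (s ℤ.* ℤ.+ m) B
ι-*-frac (suc b) m s _ =
  sym (fromℚᵘ-homo-* (mkℚᵘ s 0) (mkℚᵘ (ℤ.+ m) b)) ⟨ trans ⟩
  ℚ.fromℚᵘ-cong {mkℚᵘ s 0 ℚᵘ.* mkℚᵘ (ℤ.+ m) b} {mkℚᵘ (s ℤ.* ℤ.+ m) b}
    (*≡* (cong (s ℤ.* ℤ.+ m ℤ.*_) (sym (ℤ.*-identityˡ (ℤ.+ suc b)) ⟨ trans ⟩ sym (ℤ.pos-* 1 (suc b)))))

frac-self : ∀ a → 1 ≤ a → frac (1ℤ ℤ.* ℤ.+ a) a ≡ 1ℚ
frac-self (suc a) _ = ℚ.fromℚᵘ-cong {mkℚᵘ (1ℤ ℤ.* ℤ.+ suc a) a} {mkℚᵘ 1ℤ 0} (*≡* (begin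
  1ℤ ℤ.* ℤ.+ suc a ℤ.* 1ℤ   ≡⟨ ℤ.*-identityʳ _ ⟩
  1ℤ ℤ.* ℤ.+ suc a          ≡⟨ ℤ.*-identityˡ _ ⟩
  ℤ.+ suc a                 ≡⟨ ℤ.*-identityˡ _ ⟨
  1ℤ ℤ.* ℤ.+ suc a          ∎))
  where open ≡-Reasoning

neg-ι-neg : ∀ s K → ℚ.- (ι (ℤ.- s) ℚ.* K) ≡ ι s ℚ.* K
neg-ι-neg s K = cong (λ q → ℚ.- (q ℚ.* K)) (fromℚᵘ-homo‿- (mkℚᵘ s 0)) ⟨ trans ⟩
  cong ℚ.-_ (sym (ℚ.neg-distribˡ-* (ι s) K)) ⟨ trans ⟩ ℚ+-group.⁻¹-involutive (ι s ℚ.* K)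

-- The Möbius function at the corolla

nh-≥-legs : ∀ {g n Γ} → InG g n Γ → n ≤ nh Γ
nh-≥-legs {n = n} {Γ} G = m≤n+m n (2 * edgeCount Γ) ⟨ ≤-trans ⟩ ≤-reflexive
  (cong (2 * edgeCount Γ +_) (sym (InG.legs G)) ⟨ trans ⟩ double-edges+legs Γ (InG.involutive G))

module MöbiusFunction (g n : ℕ) (L : List Graph) (R : IsRepList g n L) where

  open Representatives R

  V : Graph
  V = Vgn g n

  closed-form : Graph → ℚ
  closed-form Γ = frac (sign (edgeCount Γ) ℤ.* ℤ.+ (n !)) (autCount Γ)

  -- Fuel  f  suffices for graphs with fewer than  f + n  half-edges: every graph of 𝒢ᶜ_{g,n} has
  -- at least  n  half-edges, and each recursive call is on a proper contraction, with 2 fewer.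
  Correct : ℕ → Set
  Correct f = ∀ Γ → InG g n Γ → nh Γ < f + n → muF L f Γ V ≡ closed-form Γ

  module Step (f : ℕ) (IH : Correct f) {Γ : Graph} (G : InG g n Γ) (nh< : nh Γ < suc f + n) where

    open ContractionSum R G

    K : ℚ
    K = frac (ℤ.+ (n !)) (autCount Γ)

    proper : Graph → ℤ
    proper y = if isoᵇ Γ y then 0ℤ else weighted y

    summand : ∀ {y} → InG g n y →
              (if ltᵇ Γ y ∧ leqᵇ y V then zeta Γ y ℚ.* muF L f y V else 0ℚ) ≡ ι (proper y) ℚ.* K
    summand {y} Gy = by-cases (isoᵇ Γ y) refl (cCount Γ y) refl
      where
      term : Bool → ℚ
      term b = if b then zeta Γ y ℚ.* muF L f y V else 0ℚ
      by-cases : ∀ b → isoᵇ Γ y ≡ b → ∀ c → cCount Γ y ≡ c →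
                 term (ltᵇ Γ y ∧ leqᵇ y V) ≡ ι (proper y) ℚ.* K
      by-cases true iso-eq _ _ =
        cong term (¬T⇒≡false λ t →
          T-not⁻ (proj₂ (to (T-∧ {leqᵇ Γ y}) (proj₁ (to (T-∧ {ltᵇ Γ y}) t)))) (from T-≡ iso-eq))
        ⟨ trans ⟩ sym (cong (λ z → ι z ℚ.* K) (if-cong iso-eq) ⟨ trans ⟩ ℚ.*-zeroˡ K)
      by-cases false iso-eq zero c-eq =
        cong term (cong (λ c → (not (c ≡ᵇ 0) ∧ not (isoᵇ Γ y)) ∧ leqᵇ y V) c-eq)
        ⟨ trans ⟩ sym (cong (λ z → ι z ℚ.* K) (if-cong iso-eq ⟨ trans ⟩ cong (λ c → ℤ.+ c ℤ.* σ y) c-eq)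
                       ⟨ trans ⟩ ℚ.*-zeroˡ K)
      by-cases false iso-eq (suc _) c-eq =
        cong term (T⇒≡true (from T-∧ (from T-∧ (Γ≤y , T-not⁺ Γ≇y) , leqᵇ-Vgn y Gy)))
        ⟨ trans ⟩ cong (zeta Γ y ℚ.*_) (IH y Gy nh-y<)
        ⟨ trans ⟩ frac-*-cancel (autCount y) (autCount Γ) (cCount Γ y) (n !) (σ y) (autCount-pos y) (autCount-pos Γ)
        ⟨ trans ⟩ cong (λ z → ι z ℚ.* K) (sym (if-cong iso-eq))
        where
        Γ≤y : T (leqᵇ Γ y)
        Γ≤y = leqᵇ⁺ Γ y (subst (1 ≤_) (sym c-eq) (s≤s z≤n))
        Γ≇y : ¬ T (isoᵇ Γ y)
        Γ≇y t = subst T iso-eq t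
        nh-y< : nh y < f + n
        nh-y< = n≤1+n _ ⟨ ≤-trans ⟩ <⇒nh-drop Γ y G Γ≤y Γ≇y ⟨ ≤-trans ⟩ ≤-pred nh<

    corolla-case : T (isoᵇ Γ V) → muF L (suc f) Γ V ≡ closed-form Γ
    corolla-case Γ≅V = if-cong (T⇒≡true Γ≅V) ⟨ trans ⟩ sym (begin
      frac (sign (edgeCount Γ) ℤ.* ℤ.+ (n !)) (autCount Γ)
        ≡⟨ cong₂ (λ e a → frac (sign e ℤ.* ℤ.+ (n !)) a) no-edges aut≡ ⟩
      frac (1ℤ ℤ.* ℤ.+ (n !)) (n !)
        ≡⟨ frac-self (n !) (subst (1 ≤_) aut≡ (autCount-pos Γ)) ⟩
      1ℚ ∎)
      where
      open ≡-Reasoning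
      iso = isoᵇ⁻ Γ V Γ≅V
      aut≡ : autCount Γ ≡ n !
      aut≡ = autCount-≅Vgn iso
      no-edges : edgeCount Γ ≡ 0
      no-edges = *-cancelˡ-≡ (edgeCount Γ) 0 2 (+-cancelʳ-≡ n _ _
        (cong (2 * edgeCount Γ +_) (sym (InG.legs G)) ⟨ trans ⟩
         double-edges+legs Γ (InG.involutive G) ⟨ trans ⟩ ≅⇒nh≡ iso))

    proper-case : ¬ T (isoᵇ Γ V) → muF L (suc f) Γ V ≡ closed-form Γ
    proper-case Γ≇V = begin
      muF L (suc f) Γ V
        ≡⟨ if-cong (¬T⇒≡false Γ≇V) ⟨ trans ⟩ if-cong (T⇒≡true (leqᵇ-Vgn Γ G)) ⟩
      ℚ.- sumℚ (map (λ y → if ltᵇ Γ y ∧ leqᵇ y V then zeta Γ y ℚ.* muF L f y V else 0ℚ) L)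
        ≡⟨ cong (λ xs → ℚ.- sumℚ xs) (map-cong-All members-InG summand) ⟩
      ℚ.- sumℚ (map (λ y → ι (proper y) ℚ.* K) L)
        ≡⟨ cong ℚ.-_ (sumℚ-ι proper K L) ⟩
      ℚ.- (ι (sumℤ (map proper L)) ℚ.* K)
        ≡⟨ cong (λ z → ℚ.- (ι z ℚ.* K)) (proper-weighted-sum Γ≇V) ⟩
      ℚ.- (ι (ℤ.- σ Γ) ℚ.* K)
        ≡⟨ neg-ι-neg (σ Γ) K ⟩
      ι (σ Γ) ℚ.* K
        ≡⟨ ι-*-frac (autCount Γ) (n !) (σ Γ) (autCount-pos Γ) ⟩
      closed-form Γ ∎
      where open ≡-Reasoning

  muF-correct : ∀ f → Correct f
  muF-correct zero    Γ G nh< = contradiction (nh-≥-legs G) (<⇒≱ nh<)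
  muF-correct (suc f) Γ G nh< with T? (isoᵇ Γ V)
  ... | yes Γ≅V = Step.corolla-case f (muF-correct f) G nh< Γ≅V
  ... | no  Γ≇V = Step.proper-case  f (muF-correct f) G nh< Γ≇V

open import Data.Integer.Base using (-1ℤ; +_; _^_) renaming (_*_ to _*ℤ_)

mainTheorem4 : (g n : ℕ) → 2 < 2 * g + n →
    (L : List Graph) → IsRepList g n L →
    (Γ : Graph) → InG g n Γ →
    mu L Γ (Vgn g n) ≡ frac ((-1ℤ ^ edgeCount Γ) *ℤ (+ (n !))) (autCount Γ)
mainTheorem4 g n _ L R Γ G = MöbiusFunction.muF-correct g n L R (suc (nh Γ)) Γ G (s≤s (m≤m+n (nh Γ) n))
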